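{- For any finite program $\Gamma$ (possibly with aggregate expressions in rule bodies), the completion of the infinitary program $\tau_1\Gamma$ is satisfied by exactly the same interpretations of the vocabulary of $\Gamma$ as the set of completed definitions of the predicate symbols occurring in $\Gamma$.
   Context: Terms are built from numerals $\overline n$ ($n\in\mathbb Z$), symbolic constants, variables, $\mathit{inf},\mathit{sup}$, $f(\mathbf t)$ ($f$ a symbolic constant), $\mathit{op}(\mathbf t)$ (each $n$-ary operation name has a function $\widehat{\mathit{op}}$ from a subset of $\mathbb Z^n$ to $\mathbb Z$), and intervals $(t_1..t_2)$. Ground = variable-free; precomputed = ground without operation names or intervals. A total order on precomputed terms ($\mathit{inf}$ least, $\mathit{sup}$ greatest, numerals ordered as integers) interprets $=,\neq,<,>,\le,\ge$. Values $[t]$ of ground terms: $\{t\}$ for numerals, symbolic constants, $\mathit{inf},\mathit{sup}$; $[f(t_1,..,t_n)]=\{f(r_1,..,r_n):r_i\in[t_i]\}$; $[\mathit{op}(t_1,..,t_n)]=\{\overline{\widehat{\mathit{op}}(k_1,..,k_n)}:(k_i)\in\mathrm{dom}\,\widehat{\mathit{op}},\overline{k_i}\in[t_i]\}$; $[(t_1..t_2)]=\{\overline m:k_1\le m\le k_2,\overline{k_1}\in[t_1],\overline{k_2}\in[t_2]\}$; $[t_1,..,t_n]$ = tuples of values. Literals: atoms $p(\mathbf t)$ or $\mathit{not}\ p(\mathbf t)$; comparisons $(t_1\prec t_2)$. Each aggregate name $\alpha$ has a function $\widehat\alpha$ from sets of non-empty tuples of precomputed terms to precomputed terms. Aggregate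 expressions: $\alpha\{\mathbf t:\mathbf C\}\prec s$ ($\mathbf t$ non-empty, $\mathbf C$ a conjunction of literals and comparisons, $s$ a variable or precomputed term), closed if $s$ is ground. A rule is $\mathit{Head}\leftarrow\mathit{Body}$, $\mathit{Body}$ a conjunction of literals, comparisons and aggregate expressions, $\mathit{Head}$ an atom (basic rule), $\{A\}$ for an atom $A$ (choice rule), or empty (constraint); a program is a set of rules. A variable of a rule is local if all its occurrences are inside the part $\alpha\{\mathbf t:\mathbf C\}$ of aggregate expressions in the body, else global. An instance of a rule is the rule obtained by substituting precomputed terms for its global variables. A predicate symbol $p/n$ occurs in $\Gamma$ if $\Gamma$ contains an atom $p(t_1,..,t_n)$; the vocabulary of $\Gamma$ consists of atoms $p(\mathbf r)$ with $\mathbf r$ an $n$-tuple of precomputed terms and $p/n$ occurring in $\Gamma$. Interpretations are sets of such atoms. Formulas and arguments (mutually recursive): formulas $p(\mathbf{arg})$, $\mathit{arg}_1\prec\mathit{arg}_2$, $\mathit{arg}\in t$ ($t$ a term), $\bot$, $F\to G$, $\forall XF$; arguments are numerals, symbolic constants, variables, $\mathit{inf},\mathit{sup}$, $f(\mathbf{arg})$, $\alpha\{\mathbf X\mid F\}$ ($\mathbf X$ non-empty tuple of distinct variables, bound in it). Semantics under $\mathcal I$: atoms true iff (arguments evaluated) in $\mathcal I$; $\prec$ via the order; $\mathit{arg}\in t$ true iff $\mathit{arg}^{\mathcal I}\in[t]$; classical connectives; $\forall$ over precomputed terms; $\alpha\{X_1..X_k\mid F\}^{\mathcal I}=\widehat\alpha(T)$,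 $T$ the tuples of precomputed terms making $F$ true. $\phi p(\mathbf t)=\exists\mathbf X(\mathbf X\in\mathbf t\wedge p(\mathbf X))$, $\phi(\mathit{not}\ p(\mathbf t))=\exists\mathbf X(\mathbf X\in\mathbf t\wedge\neg p(\mathbf X))$, $\phi(t_1\prec t_2)=\exists X_1X_2(X_1\in t_1\wedge X_2\in t_2\wedge X_1\prec X_2)$ (new variables); $\phi^{\mathbf X}$ equals $\phi$ on these, maps $\alpha\{\mathbf t:\mathbf C\}\prec s$ to $\exists Y(\alpha\{\mathbf Z\mid\exists\mathbf X(\mathbf Z\in\mathbf t\wedge\phi\mathbf C)\}\prec Y\wedge Y\in s)$ (new $\mathbf Z,Y$), and acts conjunct-wise. With $\mathbf X$ the local variables and $\mathbf V$ new: basic rule $p(\mathbf t)\leftarrow\mathit{Body}$ is represented by $\mathbf V\in\mathbf t\wedge\phi^{\mathbf X}(\mathit{Body})\to p(\mathbf V)$; choice rule $\{p(\mathbf t)\}\leftarrow\mathit{Body}$ by $\mathbf V\in\mathbf t\wedge\phi^{\mathbf X}(\mathit{Body})\wedge p(\mathbf V)\to p(\mathbf V)$. The definition of $p/n$ in $\Gamma$ consists of basic rules with head $p(t_1,..,t_n)$ and choice rules with head $\{p(t_1,..,t_n)\}$; if it is $\{R_1,..,R_k\}$ with representations $F_i\to p(\mathbf V)$ (same $\mathbf V$), the completed definition of $p/n$ is $\forall\mathbf V(p(\mathbf V)\leftrightarrow\bigvee_{i=1}^k\exists\mathbf U_iF_i)$, $\mathbf U_i$ the free variables of $F_i$ not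 in $\mathbf V$. Infinitary formulas: atoms, $\bot$, $\mathcal H^\wedge,\mathcal H^\vee$ for arbitrary sets $\mathcal H$, $G\to H$; $\neg F=F\to\bot$, $\top=\neg\bot$; classical satisfaction. $\tau p(\mathbf t)=\bigvee_{\mathbf r\in[\mathbf t]}p(\mathbf r)$, $\tau(\mathit{not}\ p(\mathbf t))=\bigvee_{\mathbf r\in[\mathbf t]}\neg p(\mathbf r)$; $\tau(t_1\prec t_2)$ is $\top$ if $r_1\prec r_2$ for some $r_i\in[t_i]$, else $\bot$; for a closed aggregate expression $E=\alpha\{\mathbf t:\mathbf C\}\prec s$ with variable list $\mathbf Y$, $A$ the tuples of precomputed terms of length $|\mathbf Y|$, $[\Delta]=\bigcup_{\mathbf r\in\Delta}[\mathbf t^{\mathbf Y}_{\mathbf r}]$, and $\Delta$ justifying $E$ iff $\widehat\alpha([\Delta])\prec s$, $\tau E$ is the conjunction over non-justifying $\Delta\subseteq A$ of $\bigwedge_{\mathbf r\in\Delta}\tau(\mathbf C^{\mathbf Y}_{\mathbf r})\to\bigvee_{\mathbf r\in A\setminus\Delta}\tau(\mathbf C^{\mathbf Y}_{\mathbf r})$; conjunct-wise on conjunctions. $\tau_1\Gamma$ is the conjunction (infinitary program) of the infinitary rules $\tau(\mathit{Body})\to p(\mathbf r)$ for all instances $p(\mathbf t)\leftarrow\mathit{Body}$ of basic rules of $\Gamma$ and $\mathbf r\in[\mathbf t]$, and $\tau(\mathit{Body})\wedge\neg\neg p(\mathbf r)\to p(\mathbf r)$ for all instances $\{p(\mathbf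 t)\}\leftarrow\mathit{Body}$ of choice rules and $\mathbf r\in[\mathbf t]$. For an infinitary program $\Pi$ (conjunction of rules $F\to A$, $A$ an atom) and atom $A$, $\Pi|_A$ is the set of $F$ with $F\to A$ a rule of $\Pi$; the completion of $\Pi$ is the conjunction of $A\leftrightarrow(\Pi|_A)^\vee$ over all atoms $A$ of the underlying signature (here the vocabulary of $\Gamma$). -}

module Defs where

open import Level using (Lift; lift; lower) renaming (zero to 0ℓ; suc to lsuc)
open import Data.Nat as ℕ using (ℕ; zero; suc; _+_; _∸_)
open import Data.Integer as ℤ using (ℤ)
open import Data.List as L using (List; []; _∷_; length; _++_; concat; concatMap; foldr; filter; deduplicate; zip; upTo; lookup)
open import Data.List.NonEmpty as L⁺ using (List⁺; _∷_; toList)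
open import Data.List.Membership.Propositional using (_∈_)
open import Data.Vec as V using (Vec; []; _∷_)
open import Data.Fin using (Fin)
open import Data.Product using (Σ; _×_; _,_; proj₁; proj₂)
open import Data.Empty using (⊥)
open import Data.Sum using (_⊎_)
open import Data.Unit using (⊤)
open import Data.Bool using (Bool; true; false; if_then_else_)
open import Data.Maybe using (Maybe; just; nothing)
open import Relation.Binary.PropositionalEquality using (_≡_; _≢_; refl; cong)
open import Relation.Binary.Definitions using (DecidableEquality)
open import Relation.Binary.Structures using (IsStrictTotalOrder)
open import Relation.Nullary using (¬_; Dec; yes; no; does; ¬?)
open import Function.Bundles using (_⇔_)

record Sig : Set₁ where
  field
    SymC     : Set
    Op       : ℕ → Set
    opDom    : ∀ {n} → Op n → Vec ℤ n → Set
    opFun    : ∀ {n} (o : Op n) (ks : Vec ℤ n) → opDom o ks → ℤ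
    AggName  : Set
    PredName : Set
    _≟P_     : DecidableEquality PredName

module Syntax (S : Sig) where
  open Sig S

  Var : Set
  Var = ℕ

  data PTerm : Set where
    pnum : ℤ → PTerm
    psym : SymC → PTerm
    pinf psup : PTerm
    pfun : SymC → List PTerm → PTerm

  data Term : Set where
    num  : ℤ → Term
    sym  : SymC → Term
    var  : Var → Term
    inf sup : Term
    fun  : SymC → List Term → Term
    op   : ∀ {n} → Op n → Vec Term n → Term
    _‥_  : Term → Term → Term

  data Rel : Set where
    eqR neR ltR gtR leR geR : Rel

  data CLit : Set where
    atomL : PredName → List Term → CLit
    notL  : PredName → List Term → CLit
    cmpL  : Rel → Term → Term → CLit

  -- right-hand side s of an aggregate expression: a variable or a precomputed term
  data Bound : Set where
    bvar : Var → Bound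
    bval : PTerm → Bound

  -- body elements: literals/comparisons and aggregate expressions
  --   agg α t C ≺ s   stands for   α{t : C} ≺ s
  data BodyElem : Set where
    lit : CLit → BodyElem
    agg : AggName → List⁺ Term → List CLit → Rel → Bound → BodyElem

  data Head : Set where
    basic  : PredName → List Term → Head
    choice : PredName → List Term → Head
    none   : Head

  record Rule : Set where
    constructor _⇐_
    field
      head : Head
      body : List BodyElem
  open Rule public

  Program : Set
  Program = List Rule

  mutual
    varsT : Term → List Var
    varsT (num _) = []
    varsT (sym _) = []
    varsT (var x) = x ∷ []
    varsT inf = []
    varsT sup = []
    varsT (fun _ ts) = varsTs ts
    varsT (op _ ts) = varsTv ts
    varsT (t₁ ‥ t₂) = varsT t₁ ++ varsT t₂

    varsTs : List Term → List Var
    varsTs [] = []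
    varsTs (t ∷ ts) = varsT t ++ varsTs ts

    varsTv : ∀ {n} → Vec Term n → List Var
    varsTv [] = []
    varsTv (t ∷ ts) = varsT t ++ varsTv ts

  varsL : CLit → List Var
  varsL (atomL _ ts) = varsTs ts
  varsL (notL _ ts) = varsTs ts
  varsL (cmpL _ t₁ t₂) = varsT t₁ ++ varsT t₂

  varsB : Bound → List Var
  varsB (bvar x) = x ∷ []
  varsB (bval _) = []

  varsH : Head → List Var
  varsH (basic _ ts) = varsTs ts
  varsH (choice _ ts) = varsTs ts
  varsH none = []

  outerVarsE : BodyElem → List Var
  outerVarsE (lit l) = varsL l
  outerVarsE (agg _ _ _ _ s) = varsB s

  innerVarsE : BodyElem → List Var
  innerVarsE (lit _) = []
  innerVarsE (agg _ ts Cs _ _) = varsTs (toList ts) ++ concatMap varsL Cs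

  _∈ℕ?_ : (x : Var) (xs : List Var) → Dec (x ∈ xs)
  x ∈ℕ? xs = Data.List.Membership.DecPropositional._∈?_ ℕ._≟_ x xs
    where import Data.List.Membership.DecPropositional

  globalVars : Rule → List Var
  globalVars R = deduplicate ℕ._≟_ (varsH (head R) ++ concatMap outerVarsE (body R))

  localVars : Rule → List Var
  localVars R =
    filter (λ x → ¬? (x ∈ℕ? globalVars R))
           (deduplicate ℕ._≟_ (concatMap innerVarsE (body R)))

  mutual
    embed : PTerm → Term
    embed (pnum n) = num n
    embed (psym c) = sym c
    embed pinf = inf
    embed psup = sup
    embed (pfun f rs) = fun f (embeds rs)

    embeds : List PTerm → List Term
    embeds [] = []
    embeds (r ∷ rs) = embed r ∷ embeds rs

  Subst : Set
  Subst = Var → Maybe PTerm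

  mutual
    substT : Subst → Term → Term
    substT σ (num n) = num n
    substT σ (sym c) = sym c
    substT σ (var x) with σ x
    ... | just r  = embed r
    ... | nothing = var x
    substT σ inf = inf
    substT σ sup = sup
    substT σ (fun f ts) = fun f (substTs σ ts)
    substT σ (op o ts) = op o (substTv σ ts)
    substT σ (t₁ ‥ t₂) = substT σ t₁ ‥ substT σ t₂

    substTs : Subst → List Term → List Term
    substTs σ [] = []
    substTs σ (t ∷ ts) = substT σ t ∷ substTs σ ts

    substTv : ∀ {n} → Subst → Vec Term n → Vec Term n
    substTv σ [] = []
    substTv σ (t ∷ ts) = substT σ t ∷ substTv σ ts

  substL : Subst → CLit → CLit
  substL σ (atomL p ts) = atomL p (substTs σ ts)
  substL σ (notL p ts) = notL p (substTs σ ts)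
  substL σ (cmpL ≺ t₁ t₂) = cmpL ≺ (substT σ t₁) (substT σ t₂)

  substB : Subst → Bound → Bound
  substB σ (bvar x) with σ x
  ... | just r  = bval r
  ... | nothing = bvar x
  substB σ (bval r) = bval r

  substE : Subst → BodyElem → BodyElem
  substE σ (lit l) = lit (substL σ l)
  substE σ (agg α ts Cs ≺ s) = agg α (L⁺.map (substT σ) ts) (L.map (substL σ) Cs) ≺ (substB σ s)

  substH : Subst → Head → Head
  substH σ (basic p ts) = basic p (substTs σ ts)
  substH σ (choice p ts) = choice p (substTs σ ts)
  substH σ none = none

  substR : Subst → Rule → Rule
  substR σ (h ⇐ b) = substH σ h ⇐ L.map (substE σ) b

  bindVars : List Var → List PTerm → Subst
  bindVars [] _ y = nothing
  bindVars (x ∷ xs) [] y = nothing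
  bindVars (x ∷ xs) (r ∷ rs) y = if does (y ℕ.≟ x) then just r else bindVars xs rs y

  instanceOf : Rule → (Var → PTerm) → Rule
  instanceOf R σ = substR (λ x → if does (x ∈ℕ? globalVars R) then just (σ x) else nothing) R

  -- values of ground terms: ⟦ t ⟧ r  means  r ∈ [t]

  mutual
    ⟦_⟧ : Term → PTerm → Set
    ⟦ num n ⟧ r = r ≡ pnum n
    ⟦ sym c ⟧ r = r ≡ psym c
    ⟦ var x ⟧ r = ⊥               -- (never used: applied to ground terms only)
    ⟦ inf ⟧ r = r ≡ pinf
    ⟦ sup ⟧ r = r ≡ psup
    ⟦ fun f ts ⟧ r = Σ (List PTerm) λ rs → r ≡ pfun f rs × ⟦ ts ⟧ˢ rs
    ⟦ op {n} o ts ⟧ r =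
      Σ (Vec ℤ n) λ ks → Σ (opDom o ks) λ d → r ≡ pnum (opFun o ks d) × ⟦ ts ⟧ᵛ ks
    ⟦ t₁ ‥ t₂ ⟧ r =
      Σ ℤ λ k₁ → Σ ℤ λ k₂ → Σ ℤ λ m →
        ⟦ t₁ ⟧ (pnum k₁) × ⟦ t₂ ⟧ (pnum k₂) × k₁ ℤ.≤ m × m ℤ.≤ k₂ × r ≡ pnum m

    ⟦_⟧ˢ : List Term → List PTerm → Set
    ⟦ [] ⟧ˢ [] = ⊤
    ⟦ [] ⟧ˢ (_ ∷ _) = ⊥
    ⟦ _ ∷ _ ⟧ˢ [] = ⊥
    ⟦ t ∷ ts ⟧ˢ (r ∷ rs) = ⟦ t ⟧ r × ⟦ ts ⟧ˢ rs

    ⟦_⟧ᵛ : ∀ {n} → Vec Term n → Vec ℤ n → Set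
    ⟦ [] ⟧ᵛ [] = ⊤
    ⟦ t ∷ ts ⟧ᵛ (k ∷ ks) = ⟦ t ⟧ (pnum k) × ⟦ ts ⟧ᵛ ks

  predsL : CLit → List (PredName × ℕ)
  predsL (atomL p ts) = (p , length ts) ∷ []
  predsL (notL p ts) = (p , length ts) ∷ []
  predsL (cmpL _ _ _) = []

  predsE : BodyElem → List (PredName × ℕ)
  predsE (lit l) = predsL l
  predsE (agg _ _ Cs _ _) = concatMap predsL Cs

  predsH : Head → List (PredName × ℕ)
  predsH (basic p ts) = (p , length ts) ∷ []
  predsH (choice p ts) = (p , length ts) ∷ []
  predsH none = []

  predsR : Rule → List (PredName × ℕ)
  predsR R = predsH (head R) ++ concatMap predsE (body R)

  Occurs : Program → PredName → ℕ → Set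
  Occurs Γ p n = (p , n) ∈ concatMap predsR Γ

  Atom : Set
  Atom = PredName × List PTerm

  Vocab : Program → Atom → Set
  Vocab Γ (p , rs) = Occurs Γ p (length rs)

  Interp : Set₁
  Interp = PredName → List PTerm → Set

  -- first-order formulas with aggregate arguments.
  -- Formula variables: program variables (pv x) and new variables (nv k).

  data FVar : Set where
    pv nv : ℕ → FVar

  _≟F_ : DecidableEquality FVar
  pv x ≟F pv y with x ℕ.≟ y
  ... | yes refl = yes refl
  ... | no x≢y = no λ { refl → x≢y refl }
  pv x ≟F nv y = no λ ()
  nv x ≟F pv y = no λ ()
  nv x ≟F nv y with x ℕ.≟ y
  ... | yes refl = yes refl
  ... | no x≢y = no λ { refl → x≢y refl }

  mutual
    data Arg : Set where
      anum : ℤ → Arg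
      asym : SymC → Arg
      avar : FVar → Arg
      ainf asup : Arg
      afun : SymC → List Arg → Arg
      aagg : AggName → List⁺ FVar → Form → Arg

    data Form : Set where
      fatom : PredName → List Arg → Form
      fcmp  : Rel → Arg → Arg → Form
      fin   : Arg → Term → Form
      f⊥    : Form
      _⟶_   : Form → Form → Form
      fall  : FVar → Form → Form

  infixr 4 _⟶_
  infixr 6 _f∧_
  infixr 5 _f∨_
  infix 4 _f↔_
  infix 7 _∈*_

  f¬ : Form → Form
  f¬ F = F ⟶ f⊥

  f⊤ : Form
  f⊤ = f¬ f⊥

  _f∧_ : Form → Form → Form
  F f∧ G = f¬ (F ⟶ f¬ G)

  _f∨_ : Form → Form → Form
  F f∨ G = f¬ F ⟶ G

  _f↔_ : Form → Form → Form
  F f↔ G = (F ⟶ G) f∧ (G ⟶ F)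

  fex : FVar → Form → Form
  fex X F = f¬ (fall X (f¬ F))

  fall* : List FVar → Form → Form
  fall* Xs F = foldr fall F Xs

  fex* : List FVar → Form → Form
  fex* Xs F = foldr fex F Xs

  bigAnd : List Form → Form
  bigAnd [] = f⊤
  bigAnd (F ∷ []) = F
  bigAnd (F ∷ Fs@(_ ∷ _)) = F f∧ bigAnd Fs

  bigOr : List Form → Form
  bigOr [] = f⊥
  bigOr (F ∷ []) = F
  bigOr (F ∷ Fs@(_ ∷ _)) = F f∨ bigOr Fs

  _∈*_ : List FVar → List Term → Form
  Xs ∈* ts = bigAnd (L.zipWith (λ X t → fin (avar X) t) Xs ts)

  news : ℕ → ℕ → List FVar
  news n k = L.map (λ i → nv (n + i)) (upTo k)

  news⁺ : ∀ {A : Set} → ℕ → List⁺ A → List⁺ FVar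
  news⁺ n (_ ∷ as) = nv n ∷ news (suc n) (length as)

  -- the translation φ; the counter supplies new variables

  φL : CLit → ℕ → Form × ℕ
  φL (atomL p ts) n =
    let Xs = news n (length ts) in
    fex* Xs (Xs ∈* ts f∧ fatom p (L.map avar Xs)) , n + length ts
  φL (notL p ts) n =
    let Xs = news n (length ts) in
    fex* Xs (Xs ∈* ts f∧ f¬ (fatom p (L.map avar Xs))) , n + length ts
  φL (cmpL ≺ t₁ t₂) n =
    fex (nv n) (fex (nv (suc n))
      (fin (avar (nv n)) t₁ f∧ (fin (avar (nv (suc n))) t₂ f∧ fcmp ≺ (avar (nv n)) (avar (nv (suc n))))))
    , suc (suc n)

  φLs : List CLit → ℕ → List Form × ℕ
  φLs [] n = [] , n
  φLs (C ∷ Cs) n =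
    let (F , n₁) = φL C n
        (Fs , n₂) = φLs Cs n₁
    in F ∷ Fs , n₂

  boundTerm : Bound → Term
  boundTerm (bvar x) = var x
  boundTerm (bval r) = embed r

  -- φ^X where X = the local variables
  φE : List Var → BodyElem → ℕ → Form × ℕ
  φE X (lit l) n = φL l n
  φE X (agg α ts Cs ≺ s) n =
    let Z  = news⁺ n ts
        k  = n + length (toList ts)
        Y  = nv k
        (Fs , n₁) = φLs Cs (suc k)
    in fex Y (fcmp ≺ (aagg α Z (fex* (L.map pv X) (toList Z ∈* toList ts f∧ bigAnd Fs))) (avar Y)
              f∧ fin (avar Y) (boundTerm s))
       , n₁

  φBody : List Var → List BodyElem → ℕ → List Form × ℕ
  φBody X [] n = [] , n
  φBody X (B ∷ Bs) n =
    let (F , n₁) = φE X B n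
        (Fs , n₂) = φBody X Bs n₁
    in F ∷ Fs , n₂

  _∈F?_ : (x : FVar) (xs : List FVar) → Dec (x ∈ xs)
  x ∈F? xs = Data.List.Membership.DecPropositional._∈?_ _≟F_ x xs
    where import Data.List.Membership.DecPropositional

  removeF : List FVar → List FVar → List FVar
  removeF Xs Ys = filter (λ y → ¬? (y ∈F? Xs)) Ys

  mutual
    fvA : Arg → List FVar
    fvA (anum _) = []
    fvA (asym _) = []
    fvA (avar X) = X ∷ []
    fvA ainf = []
    fvA asup = []
    fvA (afun _ as) = fvAs as
    fvA (aagg _ Xs F) = removeF (toList Xs) (fvF F)

    fvAs : List Arg → List FVar
    fvAs [] = []
    fvAs (a ∷ as) = fvA a ++ fvAs as

    fvF : Form → List FVar
    fvF (fatom _ as) = fvAs as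
    fvF (fcmp _ a b) = fvA a ++ fvA b
    fvF (fin a t) = fvA a ++ L.map pv (varsT t)
    fvF f⊥ = []
    fvF (F ⟶ G) = fvF F ++ fvF G
    fvF (fall X F) = removeF (X ∷ []) (fvF F)

  -- representation F → p(V) of a rule of the definition of p/n
  -- (V = nv 0, …, nv (n-1), shared by all rules)

  repBody : Rule → Maybe (PredName × ℕ × Form)
  repBody R@(basic p ts ⇐ b) =
    let V = news 0 (length ts) in
    just (p , length ts , (V ∈* ts f∧ bigAnd (proj₁ (φBody (localVars R) b (length ts)))))
  repBody R@(choice p ts ⇐ b) =
    let V = news 0 (length ts) in
    just (p , length ts , ((V ∈* ts f∧ bigAnd (proj₁ (φBody (localVars R) b (length ts))))
                           f∧ fatom p (L.map avar V)))
  repBody (none ⇐ b) = nothing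

  defDisjuncts : Program → PredName → ℕ → List Form
  defDisjuncts [] p n = []
  defDisjuncts (R ∷ Γ) p n with repBody R
  ... | nothing = defDisjuncts Γ p n
  ... | just (q , m , F) with q ≟P p | m ℕ.≟ n
  ...   | yes _ | yes _ =
            fex* (deduplicate _≟F_ (removeF (news 0 n) (fvF F))) F ∷ defDisjuncts Γ p n
  ...   | _     | _     = defDisjuncts Γ p n

  completedDef : Program → PredName → ℕ → Form
  completedDef Γ p n =
    let V = news 0 n in
    fall* V (fatom p (L.map avar V) f↔ bigOr (defDisjuncts Γ p n))

module _ (S : Sig) where
  open Sig S
  open Syntax S

  record Ctx : Set₁ where
    field
      _<ₒ_         : PTerm → PTerm → Set
      isSTO        : IsStrictTotalOrder _≡_ _<ₒ_
      inf-least    : ∀ r → r ≢ pinf → pinf <ₒ r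
      sup-greatest : ∀ r → r ≢ psup → r <ₒ psup
      num-order    : ∀ m n → (pnum m <ₒ pnum n) ⇔ (m ℤ.< n)
      aggFun       : AggName → (List PTerm → Set) → PTerm
      -- \hat{α} is a function of the *set*: equal sets give equal values
      aggFun-ext   : ∀ α (T T' : List PTerm → Set) → (∀ u → T u ⇔ T' u) →
                     aggFun α T ≡ aggFun α T'

module Semantics (S : Sig) (C : Ctx S) where
  open Sig S
  open Syntax S
  open Ctx C

  relHolds : Rel → PTerm → PTerm → Set
  relHolds eqR r s = r ≡ s
  relHolds neR r s = r ≢ s
  relHolds ltR r s = r <ₒ s
  relHolds gtR r s = s <ₒ r
  relHolds leR r s = (r <ₒ s) ⊎ (r ≡ s)
  relHolds geR r s = (s <ₒ r) ⊎ (r ≡ s)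

  data IForm : Set₂ where
    iatom : Atom → IForm
    i⊥    : IForm
    ⋀ ⋁   : (I : Set₁) → (I → IForm) → IForm
    _⇒_   : IForm → IForm → IForm

  infixr 4 _⇒_

  ⋀₀ ⋁₀ : (I : Set) → (I → IForm) → IForm
  ⋀₀ I f = ⋀ (Lift (lsuc 0ℓ) I) (λ i → f (lower i))
  ⋁₀ I f = ⋁ (Lift (lsuc 0ℓ) I) (λ i → f (lower i))

  i¬ : IForm → IForm
  i¬ F = F ⇒ i⊥

  i⊤ : IForm
  i⊤ = i¬ i⊥

  _i∧_ : IForm → IForm → IForm
  F i∧ G = ⋀₀ Bool (λ b → if b then F else G)

  _i⇔_ : IForm → IForm → IForm
  F i⇔ G = (F ⇒ G) i∧ (G ⇒ F)

  _⊨ᵢ_ : Interp → IForm → Set₁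
  I ⊨ᵢ iatom (p , rs) = Lift (lsuc 0ℓ) (I p rs)
  I ⊨ᵢ i⊥ = Lift (lsuc 0ℓ) ⊥
  I ⊨ᵢ ⋀ J f = (j : J) → I ⊨ᵢ f j
  I ⊨ᵢ ⋁ J f = Σ J λ j → I ⊨ᵢ f j
  I ⊨ᵢ (F ⇒ G) = I ⊨ᵢ F → I ⊨ᵢ G

  τL : CLit → IForm
  τL (atomL p ts) = ⋁₀ (Σ (List PTerm) ⟦ ts ⟧ˢ) (λ rs → iatom (p , proj₁ rs))
  τL (notL p ts) = ⋁₀ (Σ (List PTerm) ⟦ ts ⟧ˢ) (λ rs → i¬ (iatom (p , proj₁ rs)))
  -- ⊤ if r₁ ≺ r₂ for some r₁ ∈ [t₁], r₂ ∈ [t₂], else ⊥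
  -- (encoded as the disjunction of ⊤ over all such witnesses)
  τL (cmpL ≺ t₁ t₂) =
    ⋁₀ (Σ PTerm λ r₁ → Σ PTerm λ r₂ → ⟦ t₁ ⟧ r₁ × ⟦ t₂ ⟧ r₂ × relHolds ≺ r₁ r₂) (λ _ → i⊤)

  τC : List CLit → IForm
  τC Cs = ⋀₀ (Fin (length Cs)) (λ i → τL (lookup Cs i))

  boundVal : Bound → PTerm → Set
  boundVal (bvar _) _ = ⊥      -- (never used: s is ground in a closed aggregate expression)
  boundVal (bval r) v = v ≡ r

  τAgg : AggName → List⁺ Term → List CLit → Rel → Bound → IForm
  τAgg α ts Cs ≺ s =
    ⋀ (Σ (A → Set) λ Δ → ¬ Justifies Δ)
      (λ Δ → ⋀₀ (Σ A (proj₁ Δ)) (λ r → τC (CY (proj₁ r)))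
           ⇒ ⋁₀ (Σ A (λ r → ¬ proj₁ Δ r)) (λ r → τC (CY (proj₁ r))))
    where
      Y : List Var
      Y = deduplicate ℕ._≟_ (varsTs (toList ts) ++ concatMap varsL Cs)
      A : Set
      A = Vec PTerm (length Y)
      σ : A → Subst
      σ r = bindVars Y (V.toList r)
      CY : A → List CLit
      CY r = L.map (substL (σ r)) Cs
      tY : A → List Term
      tY r = substTs (σ r) (toList ts)
      ⟦Δ⟧ : (A → Set) → List PTerm → Set
      ⟦Δ⟧ Δ u = Σ A λ r → Δ r × ⟦ tY r ⟧ˢ u
      Justifies : (A → Set) → Set
      Justifies Δ = Σ PTerm λ v → boundVal s v × relHolds ≺ (aggFun α (⟦Δ⟧ Δ)) v

  τE : BodyElem → IForm
  τE (lit l) = τL l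
  τE (agg α ts Cs ≺ s) = τAgg α ts Cs ≺ s

  τBody : List BodyElem → IForm
  τBody Bs = ⋀₀ (Fin (length Bs)) (λ i → τE (lookup Bs i))

  record IRule : Set₂ where
    constructor _⟸_
    field
      ihead : Atom
      ibody : IForm

  record IProgram : Set₃ where
    field
      Ix   : Set₁
      rule : Ix → IRule

  HeadIx : Head → Set
  HeadIx (basic p ts) = Σ (List PTerm) ⟦ ts ⟧ˢ
  HeadIx (choice p ts) = Σ (List PTerm) ⟦ ts ⟧ˢ
  HeadIx none = ⊥

  headRule : (h : Head) → List BodyElem → HeadIx h → IRule
  headRule (basic p ts) b (rs , _) = (p , rs) ⟸ τBody b
  headRule (choice p ts) b (rs , _) = (p , rs) ⟸ (τBody b i∧ i¬ (i¬ (iatom (p , rs))))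

  τ₁ : Program → IProgram
  τ₁ Γ = record
    { Ix   = Lift (lsuc 0ℓ) (Σ (Fin (length Γ)) λ i → Σ (Var → PTerm) λ σ →
                               HeadIx (head (instanceOf (lookup Γ i) σ)))
    ; rule = λ { (lift (i , σ , j)) →
                   headRule (head (instanceOf (lookup Γ i) σ)) (body (instanceOf (lookup Γ i) σ)) j } }

  completion : (Atom → Set) → IProgram → IForm
  completion Voc Π =
    ⋀₀ (Σ Atom Voc) λ A →
      iatom (proj₁ A) i⇔
        ⋁ (Σ (IProgram.Ix Π) λ i → IRule.ihead (IProgram.rule Π i) ≡ proj₁ A)
          (λ i → IRule.ibody (IProgram.rule Π (proj₁ i)))

  Env : Set
  Env = FVar → PTerm

  update : Env → FVar → PTerm → Env
  update ρ X r Y = if does (Y ≟F X) then r else ρ Y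

  updates : Env → List FVar → List PTerm → Env
  updates ρ (X ∷ Xs) (r ∷ rs) = updates (update ρ X r) Xs rs
  updates ρ _ _ = ρ

  groundT : Env → Term → Term
  groundT ρ = substT (λ x → just (ρ (pv x)))

  module FO (I : Interp) where
    mutual
      evalA : Env → Arg → PTerm
      evalA ρ (anum n) = pnum n
      evalA ρ (asym c) = psym c
      evalA ρ (avar X) = ρ X
      evalA ρ ainf = pinf
      evalA ρ asup = psup
      evalA ρ (afun f as) = pfun f (evalAs ρ as)
      evalA ρ (aagg α Xs F) =
        aggFun α (λ u → length u ≡ length (toList Xs) × sat (updates ρ (toList Xs) u) F)

      evalAs : Env → List Arg → List PTerm
      evalAs ρ [] = []
      evalAs ρ (a ∷ as) = evalA ρ a ∷ evalAs ρ as

      sat : Env → Form → Set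
      sat ρ (fatom p as) = I p (evalAs ρ as)
      sat ρ (fcmp ≺ a b) = relHolds ≺ (evalA ρ a) (evalA ρ b)
      sat ρ (fin a t) = ⟦ groundT ρ t ⟧ (evalA ρ a)
      sat ρ f⊥ = ⊥
      sat ρ (F ⟶ G) = sat ρ F → sat ρ G
      sat ρ (fall X F) = (r : PTerm) → sat (update ρ X r) F

  -- satisfaction of a sentence (the environment is irrelevant)
  _⊨_ : Interp → Form → Set
  I ⊨ F = FO.sat I (λ _ → pinf) F

-- For each atom p(rs) of the vocabulary, both sides equate p(rs) with a disjunction indexed
-- by the rules R defining p/n: the completion of τ₁ Γ with the disjunction of the bodies of the
-- infinitary rules with head p(rs) coming from instances of R, the completed definition with
-- the disjunction of the formulas ∃U F_R at V := rs.  These disjuncts agree because φ is sound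
-- for τ: under an environment ρ, φ of a rule body holds iff τ holds for the instance of the
-- body that sends every global variable x to ρ(x).  For an aggregate expression, the set comprehension built by φ denotes
-- exactly the set of tuples whose conditions hold, and τ of the expression holds iff this set
-- justifies it.  Since ∧, ∨ and ∃ are encoded by →, ⊥ and ∀, the argument uses excluded middle.

module Submission where

open import Defs
open import Level using (lift; lower) renaming (zero to 0ℓ; suc to lsuc)
open import Data.List as L using (List; []; _∷_; length; _++_; concatMap; deduplicate; lookup)
open import Data.List.NonEmpty as L⁺ using (List⁺; _∷_; toList)
open import Data.List.Membership.Propositional using (_∈_; _∉_)
open import Data.List.Membership.Propositional.Properties
  using (∈-++⁺ˡ; ∈-++⁺ʳ; ∈-++⁻; ∈-map⁺; ∈-map⁻; ∈-filter⁺; ∈-filter⁻;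
         ∈-deduplicate⁺; ∈-deduplicate⁻; ∈-concat⁺′)
open import Data.List.Properties using (length-map; length-upTo; map-cong-local)
open import Data.List.Relation.Unary.All as All using (All; []; _∷_)
open import Data.List.Relation.Unary.All.Properties using (All¬⇒¬Any)
open import Data.List.Relation.Unary.Any using (Any; here; there)
open import Data.List.Relation.Unary.Unique.Propositional using (Unique)
import Data.List.Relation.Unary.AllPairs as AllPairs
import Data.List.Relation.Unary.Unique.Propositional.Properties as Unique
open import Data.Vec as V using (Vec; []; _∷_)
open import Data.Vec.Properties using (toList-map; toList∘fromList; length-toList)
open import Data.Fin as Fin using (Fin)
open import Data.Nat as ℕ using (ℕ; suc; _+_)
open import Data.Nat.Properties using (suc-injective; +-cancelˡ-≡; m≤m+n; n≮n)
open import Data.Product using (Σ; _×_; _,_; proj₁; proj₂; swap)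
open import Data.Product.Function.NonDependent.Propositional using (_×-⇔_)
open import Data.Sum using (_⊎_; inj₁; inj₂; [_,_]′)
open import Data.Empty using (⊥; ⊥-elim)
open import Data.Maybe using (Maybe; just; nothing; fromMaybe; _<∣>_)
open import Data.Bool using (if_then_else_; true; false)
open import Relation.Nullary using (¬_; Dec; yes; no; does; ¬?)
open import Relation.Nullary.Decidable using (dec-true; dec-false; map′; decidable-stable)
open import Relation.Binary.PropositionalEquality
  using (_≡_; _≢_; refl; trans; cong; cong₂; subst; subst₂)
  renaming (sym to ≡-sym)
open import Axiom.ExcludedMiddle using (ExcludedMiddle)
open import Function.Base using (_∘_)
open import Function.Bundles using (_⇔_; mk⇔; Equivalence)
open Equivalence using (to; from)
import Function.Properties.Equivalence as ⇔

≡⇒⇔ : ∀ {a} {A B : Set a} → A ≡ B → A ⇔ B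
≡⇒⇔ refl = ⇔.refl

∃-⇔ : ∀ {a b c} {A : Set a} {B : A → Set b} {C : A → Set c} → (∀ x → B x ⇔ C x) → Σ A B ⇔ Σ A C
∃-⇔ e = mk⇔ (λ (x , b) → x , to (e x) b) (λ (x , c) → x , from (e x) c)

⇔-cong : ∀ {a b c d} {A : Set a} {A′ : Set b} {B : Set c} {B′ : Set d} →
         A ⇔ A′ → B ⇔ B′ → (A ⇔ B) ⇔ (A′ ⇔ B′)
⇔-cong a b = mk⇔ (λ e → ⇔.trans (⇔.sym a) (⇔.trans e b))
                 (λ e → ⇔.trans a (⇔.trans e (⇔.sym b)))

module TermProperties (S : Sig) where
  open Sig S
  open Syntax S

  substVar : Maybe PTerm → Var → Term
  substVar (just r) _ = embed r
  substVar nothing x = var x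

  substT-var : ∀ σ x → substT σ (var x) ≡ substVar (σ x) x
  substT-var σ x with σ x
  ... | just r = refl
  ... | nothing = refl

  _⊕_ : Subst → Subst → Subst
  (σ₁ ⊕ σ₂) x = σ₁ x <∣> σ₂ x

  mutual
    substT-embed : ∀ σ r → substT σ (embed r) ≡ embed r
    substT-embed σ (pnum _) = refl
    substT-embed σ (psym _) = refl
    substT-embed σ pinf = refl
    substT-embed σ psup = refl
    substT-embed σ (pfun f rs) = cong (fun f) (substTs-embeds σ rs)

    substTs-embeds : ∀ σ rs → substTs σ (embeds rs) ≡ embeds rs
    substTs-embeds σ [] = refl
    substTs-embeds σ (r ∷ rs) = cong₂ _∷_ (substT-embed σ r) (substTs-embeds σ rs)

  substVar-⊕ : ∀ σ₁ σ₂ x → substT σ₂ (substVar (σ₁ x) x) ≡ substVar ((σ₁ ⊕ σ₂) x) x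
  substVar-⊕ σ₁ σ₂ x with σ₁ x
  ... | just r = substT-embed σ₂ r
  ... | nothing = substT-var σ₂ x

  mutual
    substT-⊕ : ∀ σ₁ σ₂ t → substT σ₂ (substT σ₁ t) ≡ substT (σ₁ ⊕ σ₂) t
    substT-⊕ σ₁ σ₂ (num _) = refl
    substT-⊕ σ₁ σ₂ (sym _) = refl
    substT-⊕ σ₁ σ₂ (var x) = trans (cong (substT σ₂) (substT-var σ₁ x))
                             (trans (substVar-⊕ σ₁ σ₂ x) (≡-sym (substT-var (σ₁ ⊕ σ₂) x)))
    substT-⊕ σ₁ σ₂ inf = refl
    substT-⊕ σ₁ σ₂ sup = refl
    substT-⊕ σ₁ σ₂ (fun f ts) = cong (fun f) (substTs-⊕ σ₁ σ₂ ts)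
    substT-⊕ σ₁ σ₂ (op o ts) = cong (op o) (substTv-⊕ σ₁ σ₂ ts)
    substT-⊕ σ₁ σ₂ (t₁ ‥ t₂) = cong₂ _‥_ (substT-⊕ σ₁ σ₂ t₁) (substT-⊕ σ₁ σ₂ t₂)

    substTs-⊕ : ∀ σ₁ σ₂ ts → substTs σ₂ (substTs σ₁ ts) ≡ substTs (σ₁ ⊕ σ₂) ts
    substTs-⊕ σ₁ σ₂ [] = refl
    substTs-⊕ σ₁ σ₂ (t ∷ ts) = cong₂ _∷_ (substT-⊕ σ₁ σ₂ t) (substTs-⊕ σ₁ σ₂ ts)

    substTv-⊕ : ∀ {n} σ₁ σ₂ (ts : Vec Term n) → substTv σ₂ (substTv σ₁ ts) ≡ substTv (σ₁ ⊕ σ₂) ts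
    substTv-⊕ σ₁ σ₂ [] = refl
    substTv-⊕ σ₁ σ₂ (t ∷ ts) = cong₂ _∷_ (substT-⊕ σ₁ σ₂ t) (substTv-⊕ σ₁ σ₂ ts)

  substL-⊕ : ∀ σ₁ σ₂ l → substL σ₂ (substL σ₁ l) ≡ substL (σ₁ ⊕ σ₂) l
  substL-⊕ σ₁ σ₂ (atomL p ts) = cong (atomL p) (substTs-⊕ σ₁ σ₂ ts)
  substL-⊕ σ₁ σ₂ (notL p ts) = cong (notL p) (substTs-⊕ σ₁ σ₂ ts)
  substL-⊕ σ₁ σ₂ (cmpL ≺ t₁ t₂) = cong₂ (cmpL ≺) (substT-⊕ σ₁ σ₂ t₁) (substT-⊕ σ₁ σ₂ t₂)

  map-substL-⊕ : ∀ σ₁ σ₂ Cs →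
                 L.map (substL σ₂) (L.map (substL σ₁) Cs) ≡ L.map (substL (σ₁ ⊕ σ₂)) Cs
  map-substL-⊕ σ₁ σ₂ [] = refl
  map-substL-⊕ σ₁ σ₂ (C ∷ Cs) = cong₂ _∷_ (substL-⊕ σ₁ σ₂ C) (map-substL-⊕ σ₁ σ₂ Cs)

  mutual
    substT-cong : ∀ σ σ′ t → (∀ x → x ∈ varsT t → σ x ≡ σ′ x) → substT σ t ≡ substT σ′ t
    substT-cong σ σ′ (num _) h = refl
    substT-cong σ σ′ (sym _) h = refl
    substT-cong σ σ′ (var x) h = trans (substT-var σ x)
      (trans (cong (λ m → substVar m x) (h x (here refl))) (≡-sym (substT-var σ′ x)))
    substT-cong σ σ′ inf h = refl
    substT-cong σ σ′ sup h = refl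
    substT-cong σ σ′ (fun f ts) h = cong (fun f) (substTs-cong σ σ′ ts h)
    substT-cong σ σ′ (op o ts) h = cong (op o) (substTv-cong σ σ′ ts h)
    substT-cong σ σ′ (t₁ ‥ t₂) h =
      cong₂ _‥_ (substT-cong σ σ′ t₁ (λ x m → h x (∈-++⁺ˡ m)))
                (substT-cong σ σ′ t₂ (λ x m → h x (∈-++⁺ʳ (varsT t₁) m)))

    substTs-cong : ∀ σ σ′ ts → (∀ x → x ∈ varsTs ts → σ x ≡ σ′ x) → substTs σ ts ≡ substTs σ′ ts
    substTs-cong σ σ′ [] h = refl
    substTs-cong σ σ′ (t ∷ ts) h =
      cong₂ _∷_ (substT-cong σ σ′ t (λ x m → h x (∈-++⁺ˡ m)))
                (substTs-cong σ σ′ ts (λ x m → h x (∈-++⁺ʳ (varsT t) m)))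

    substTv-cong : ∀ {n} σ σ′ (ts : Vec Term n) → (∀ x → x ∈ varsTv ts → σ x ≡ σ′ x) →
                   substTv σ ts ≡ substTv σ′ ts
    substTv-cong σ σ′ [] h = refl
    substTv-cong σ σ′ (t ∷ ts) h =
      cong₂ _∷_ (substT-cong σ σ′ t (λ x m → h x (∈-++⁺ˡ m)))
                (substTv-cong σ σ′ ts (λ x m → h x (∈-++⁺ʳ (varsT t) m)))

  ∈-varsT-substVar : ∀ σ x → σ x ≡ nothing → x ∈ varsT (substT σ (var x))
  ∈-varsT-substVar σ x eq rewrite substT-var σ x | eq = here refl

  mutual
    ∈-varsT-substT : ∀ σ x t → x ∈ varsT t → σ x ≡ nothing → x ∈ varsT (substT σ t)
    ∈-varsT-substT σ x (var y) (here refl) eq = ∈-varsT-substVar σ x eq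
    ∈-varsT-substT σ x (fun f ts) m eq = ∈-varsTs-substTs σ x ts m eq
    ∈-varsT-substT σ x (op o ts) m eq = ∈-varsTv-substTv σ x ts m eq
    ∈-varsT-substT σ x (t₁ ‥ t₂) m eq with ∈-++⁻ (varsT t₁) m
    ... | inj₁ m₁ = ∈-++⁺ˡ (∈-varsT-substT σ x t₁ m₁ eq)
    ... | inj₂ m₂ = ∈-++⁺ʳ (varsT (substT σ t₁)) (∈-varsT-substT σ x t₂ m₂ eq)

    ∈-varsTs-substTs : ∀ σ x ts → x ∈ varsTs ts → σ x ≡ nothing → x ∈ varsTs (substTs σ ts)
    ∈-varsTs-substTs σ x (t ∷ ts) m eq with ∈-++⁻ (varsT t) m
    ... | inj₁ m₁ = ∈-++⁺ˡ (∈-varsT-substT σ x t m₁ eq)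
    ... | inj₂ m₂ = ∈-++⁺ʳ (varsT (substT σ t)) (∈-varsTs-substTs σ x ts m₂ eq)

    ∈-varsTv-substTv : ∀ {n} σ x (ts : Vec Term n) → x ∈ varsTv ts → σ x ≡ nothing →
                       x ∈ varsTv (substTv σ ts)
    ∈-varsTv-substTv σ x (t ∷ ts) m eq with ∈-++⁻ (varsT t) m
    ... | inj₁ m₁ = ∈-++⁺ˡ (∈-varsT-substT σ x t m₁ eq)
    ... | inj₂ m₂ = ∈-++⁺ʳ (varsT (substT σ t)) (∈-varsTv-substTv σ x ts m₂ eq)

  ∈-varsL-substL : ∀ σ x l → x ∈ varsL l → σ x ≡ nothing → x ∈ varsL (substL σ l)
  ∈-varsL-substL σ x (atomL p ts) m e = ∈-varsTs-substTs σ x ts m e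
  ∈-varsL-substL σ x (notL p ts) m e = ∈-varsTs-substTs σ x ts m e
  ∈-varsL-substL σ x (cmpL ≺ t₁ t₂) m e with ∈-++⁻ (varsT t₁) m
  ... | inj₁ m₁ = ∈-++⁺ˡ (∈-varsT-substT σ x t₁ m₁ e)
  ... | inj₂ m₂ = ∈-++⁺ʳ (varsT (substT σ t₁)) (∈-varsT-substT σ x t₂ m₂ e)

  ∈-varsLs-substLs : ∀ σ x Cs → x ∈ concatMap varsL Cs → σ x ≡ nothing →
                     x ∈ concatMap varsL (L.map (substL σ) Cs)
  ∈-varsLs-substLs σ x (C ∷ Cs) m e with ∈-++⁻ (varsL C) m
  ... | inj₁ m₁ = ∈-++⁺ˡ (∈-varsL-substL σ x C m₁ e)
  ... | inj₂ m₂ = ∈-++⁺ʳ (varsL (substL σ C)) (∈-varsLs-substLs σ x Cs m₂ e)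

  substTs≡map : ∀ σ ts → substTs σ ts ≡ L.map (substT σ) ts
  substTs≡map σ [] = refl
  substTs≡map σ (t ∷ ts) = cong (substT σ t ∷_) (substTs≡map σ ts)

  length-substTs : ∀ σ ts → length (substTs σ ts) ≡ length ts
  length-substTs σ [] = refl
  length-substTs σ (t ∷ ts) = cong suc (length-substTs σ ts)

  substB-bvar : ∀ θ x r → θ x ≡ just r → substB θ (bvar x) ≡ bval r
  substB-bvar θ x r e with θ x
  substB-bvar θ x r refl | just .r = refl

  mutual
    embed-∈⟦⟧ : ∀ r → ⟦ embed r ⟧ r
    embed-∈⟦⟧ (pnum _) = refl
    embed-∈⟦⟧ (psym _) = refl
    embed-∈⟦⟧ pinf = refl
    embed-∈⟦⟧ psup = refl
    embed-∈⟦⟧ (pfun f rs) = rs , refl , embeds-∈⟦⟧ˢ rs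

    embeds-∈⟦⟧ˢ : ∀ rs → ⟦ embeds rs ⟧ˢ rs
    embeds-∈⟦⟧ˢ [] = _
    embeds-∈⟦⟧ˢ (r ∷ rs) = embed-∈⟦⟧ r , embeds-∈⟦⟧ˢ rs

  mutual
    ⟦embed⟧-unique : ∀ r v → ⟦ embed r ⟧ v → v ≡ r
    ⟦embed⟧-unique (pnum _) v e = e
    ⟦embed⟧-unique (psym _) v e = e
    ⟦embed⟧-unique pinf v e = e
    ⟦embed⟧-unique psup v e = e
    ⟦embed⟧-unique (pfun f rs) v (rs′ , refl , e) = cong (pfun f) (⟦embeds⟧-unique rs rs′ e)

    ⟦embeds⟧-unique : ∀ rs vs → ⟦ embeds rs ⟧ˢ vs → vs ≡ rs
    ⟦embeds⟧-unique [] [] e = refl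
    ⟦embeds⟧-unique (r ∷ rs) (v ∷ vs) (e , es) =
      cong₂ _∷_ (⟦embed⟧-unique r v e) (⟦embeds⟧-unique rs vs es)

  ⟦embed⟧⇔≡ : ∀ r v → ⟦ embed r ⟧ v ⇔ (v ≡ r)
  ⟦embed⟧⇔≡ r v = mk⇔ (⟦embed⟧-unique r v) (λ { refl → embed-∈⟦⟧ r })

  ⟦⟧ˢ-length : ∀ ts rs → ⟦ ts ⟧ˢ rs → length rs ≡ length ts
  ⟦⟧ˢ-length [] [] _ = refl
  ⟦⟧ˢ-length (t ∷ ts) (r ∷ rs) (_ , h) = cong suc (⟦⟧ˢ-length ts rs h)

  bindVars-here : ∀ x xs r rs → bindVars (x ∷ xs) (r ∷ rs) x ≡ just r
  bindVars-here x xs r rs rewrite dec-true (x ℕ.≟ x) refl = refl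

  bindVars-there : ∀ x xs r rs y → y ≢ x → bindVars (x ∷ xs) (r ∷ rs) y ≡ bindVars xs rs y
  bindVars-there x xs r rs y y≢x rewrite dec-false (y ℕ.≟ x) y≢x = refl

  bindVars-map : ∀ (g : Var → PTerm) ys x → x ∈ ys → bindVars ys (L.map g ys) x ≡ just (g x)
  bindVars-map g (y ∷ ys) x m with x ℕ.≟ y
  ... | yes refl = bindVars-here x ys (g x) (L.map g ys)
  bindVars-map g (y ∷ ys) x (here x≡y) | no x≢y = ⊥-elim (x≢y x≡y)
  bindVars-map g (y ∷ ys) x (there m) | no x≢y =
    trans (bindVars-there y ys (g y) (L.map g ys) x x≢y) (bindVars-map g ys x m)

  bindVars-defined : ∀ ys rs x → x ∈ ys → length rs ≡ length ys →
                     Σ PTerm λ v → bindVars ys rs x ≡ just v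
  bindVars-defined (y ∷ ys) [] x m ()
  bindVars-defined (y ∷ ys) (r ∷ rs) x m l with x ℕ.≟ y
  ... | yes refl = r , bindVars-here x ys r rs
  bindVars-defined (y ∷ ys) (r ∷ rs) x (here x≡y) l | no x≢y = ⊥-elim (x≢y x≡y)
  bindVars-defined (y ∷ ys) (r ∷ rs) x (there m) l | no x≢y =
    let v , e = bindVars-defined ys rs x m (suc-injective l)
    in v , trans (bindVars-there y ys r rs x x≢y) e

  news-unique : ∀ n k → Unique (news n k)
  news-unique n k = Unique.map⁺ (λ {i} {j} e → +-cancelˡ-≡ n i j (nv-injective e)) (Unique.upTo⁺ k)
    where
      nv-injective : ∀ {a b} → nv a ≡ nv b → a ≡ b
      nv-injective refl = refl

  length-news : ∀ n k → length (news n k) ≡ k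
  length-news n k = trans (length-map _ (L.upTo k)) (length-upTo k)

  pv∉news : ∀ x n k → pv x ∉ news n k
  pv∉news x n k m with ∈-map⁻ (λ i → nv (n + i)) m
  ... | _ , _ , ()

  news-≥ : ∀ m n k → nv m ∈ news n k → n ℕ.≤ m
  news-≥ m n k mem with ∈-map⁻ (λ i → nv (n + i)) mem
  ... | i , _ , refl = m≤m+n n i

  pv-∈-map : ∀ x X → pv x ∈ L.map pv X → x ∈ X
  pv-∈-map x X m with ∈-map⁻ pv m
  ... | y , m′ , refl = m′

  -- instanceOf R σ = substR (instanceSubst R σ) R
  instanceSubst : Rule → (Var → PTerm) → Subst
  instanceSubst R σ x = if does (x ∈ℕ? globalVars R) then just (σ x) else nothing

  instanceSubst-global : ∀ R σ x → x ∈ globalVars R → instanceSubst R σ x ≡ just (σ x)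
  instanceSubst-global R σ x m rewrite dec-true (x ∈ℕ? globalVars R) m = refl

  instanceSubst-local : ∀ R σ x → x ∉ globalVars R → instanceSubst R σ x ≡ nothing
  instanceSubst-local R σ x m rewrite dec-false (x ∈ℕ? globalVars R) m = refl

  head-var-global : ∀ R x → x ∈ varsH (head R) → x ∈ globalVars R
  head-var-global R x m = ∈-deduplicate⁺ ℕ._≟_ (∈-++⁺ˡ m)

  outer-var-global : ∀ R B x → B ∈ body R → x ∈ outerVarsE B → x ∈ globalVars R
  outer-var-global R B x mB m =
    ∈-deduplicate⁺ ℕ._≟_ (∈-++⁺ʳ (varsH (head R)) (∈-concat⁺′ m (∈-map⁺ outerVarsE mB)))

  inner-var-local : ∀ R B x → B ∈ body R → x ∈ innerVarsE B → x ∉ globalVars R → x ∈ localVars R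
  inner-var-local R B x mB m ng = ∈-filter⁺ (λ y → ¬? (y ∈ℕ? globalVars R))
    (∈-deduplicate⁺ ℕ._≟_ (∈-concat⁺′ m (∈-map⁺ innerVarsE mB))) ng

  local⇒¬global : ∀ R x → x ∈ localVars R → x ∉ globalVars R
  local⇒¬global R x m = proj₂ (∈-filter⁻ (λ y → ¬? (y ∈ℕ? globalVars R))
    {xs = deduplicate ℕ._≟_ (concatMap innerVarsE (body R))} m)

module EnvironmentProperties (S : Sig) (C : Ctx S) where
  open Sig S
  open Syntax S
  open Ctx C
  open Semantics S C
  open TermProperties S

  update-cong : ∀ ρ ρ′ X r Y → ρ Y ≡ ρ′ Y → update ρ X r Y ≡ update ρ′ X r Y
  update-cong ρ ρ′ X r Y e with Y ≟F X
  ... | yes _ = refl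
  ... | no _ = e

  update-≡ : ∀ ρ X r → update ρ X r X ≡ r
  update-≡ ρ X r with X ≟F X
  ... | yes _ = refl
  ... | no X≢X = ⊥-elim (X≢X refl)

  update-≢ : ∀ ρ X r Y → Y ≢ X → update ρ X r Y ≡ ρ Y
  update-≢ ρ X r Y Y≢X with Y ≟F X
  ... | yes Y≡X = ⊥-elim (Y≢X Y≡X)
  ... | no _ = refl

  updates-cong : ∀ ρ ρ′ Xs u Y → ρ Y ≡ ρ′ Y → updates ρ Xs u Y ≡ updates ρ′ Xs u Y
  updates-cong ρ ρ′ [] u Y e = e
  updates-cong ρ ρ′ (X ∷ Xs) [] Y e = e
  updates-cong ρ ρ′ (X ∷ Xs) (r ∷ u) Y e =
    updates-cong (update ρ X r) (update ρ′ X r) Xs u Y (update-cong ρ ρ′ X r Y e)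

  updates-∈ : ∀ ρ ρ′ Xs u Y → Y ∈ Xs → length u ≡ length Xs → updates ρ Xs u Y ≡ updates ρ′ Xs u Y
  updates-∈ ρ ρ′ (X ∷ Xs) [] Y m ()
  updates-∈ ρ ρ′ (X ∷ Xs) (r ∷ u) Y (here refl) l =
    updates-cong (update ρ X r) (update ρ′ X r) Xs u Y
                 (trans (update-≡ ρ X r) (≡-sym (update-≡ ρ′ X r)))
  updates-∈ ρ ρ′ (X ∷ Xs) (r ∷ u) Y (there m) l =
    updates-∈ (update ρ X r) (update ρ′ X r) Xs u Y m (suc-injective l)

  updates-∉ : ∀ ρ Xs u Y → Y ∉ Xs → updates ρ Xs u Y ≡ ρ Y
  updates-∉ ρ [] u Y n = refl
  updates-∉ ρ (X ∷ Xs) [] Y n = refl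
  updates-∉ ρ (X ∷ Xs) (r ∷ u) Y n =
    trans (updates-∉ (update ρ X r) Xs u Y (λ m → n (there m))) (update-≢ ρ X r Y (λ e → n (here e)))

  updates-map : ∀ ρ (f : FVar → PTerm) Xs Y → Y ∈ Xs → updates ρ Xs (L.map f Xs) Y ≡ f Y
  updates-map ρ f (X ∷ Xs) Y (there m) = updates-map (update ρ X (f X)) f Xs Y m
  updates-map ρ f (X ∷ Xs) Y (here refl) with Y ∈F? Xs
  ... | yes m = updates-map (update ρ X (f X)) f Xs Y m
  ... | no n = trans (updates-∉ (update ρ X (f X)) Xs (L.map f Xs) Y n) (update-≡ ρ X (f X))

  map-updates : ∀ ρ Xs u → Unique Xs → length u ≡ length Xs → L.map (updates ρ Xs u) Xs ≡ u
  map-updates ρ [] [] _ _ = refl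
  map-updates ρ (X ∷ Xs) [] _ ()
  map-updates ρ (X ∷ Xs) (r ∷ u) (X∉Xs AllPairs.∷ un) l =
    cong₂ _∷_ (trans (updates-∉ (update ρ X r) Xs u X (All¬⇒¬Any X∉Xs)) (update-≡ ρ X r))
              (map-updates (update ρ X r) Xs u un (suc-injective l))

  globalsOf : Env → Var → PTerm
  globalsOf ρ x = ρ (pv x)

  groundSubst : Env → Subst
  groundSubst ρ x = just (globalsOf ρ x)

  Agree : Env → Env → List FVar → Set
  Agree ρ ρ′ Xs = ∀ X → X ∈ Xs → ρ X ≡ ρ′ X

  map-agree-updates : ∀ ρ Xs rs ρ′ → Unique Xs → length rs ≡ length Xs →
                      Agree ρ′ (updates ρ Xs rs) Xs → L.map ρ′ Xs ≡ rs
  map-agree-updates ρ Xs rs ρ′ u l h = trans (map-cong-local (All.tabulate (h _))) (map-updates ρ Xs rs u l)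


  agree-updates : ∀ ρ ρ′ Xs Ys → Agree ρ ρ′ (removeF Xs Ys) → ∀ u → length u ≡ length Xs →
                  Agree (updates ρ Xs u) (updates ρ′ Xs u) Ys
  agree-updates ρ ρ′ Xs Ys h u l Y m with Y ∈F? Xs
  ... | yes mX = updates-∈ ρ ρ′ Xs u Y mX l
  ... | no nX = updates-cong ρ ρ′ Xs u Y (h Y (∈-filter⁺ (λ y → ¬? (y ∈F? Xs)) m nX))

  groundT-cong : ∀ ρ ρ′ t → (∀ x → x ∈ varsT t → ρ (pv x) ≡ ρ′ (pv x)) → groundT ρ t ≡ groundT ρ′ t
  groundT-cong ρ ρ′ t h = substT-cong _ _ t (λ x m → cong just (h x m))

  module Coincidence (I : Interp) where
    open FO I

    mutual
      evalA-coincidence : ∀ ρ ρ′ a → Agree ρ ρ′ (fvA a) → evalA ρ a ≡ evalA ρ′ a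
      evalA-coincidence ρ ρ′ (anum _) h = refl
      evalA-coincidence ρ ρ′ (asym _) h = refl
      evalA-coincidence ρ ρ′ (avar X) h = h X (here refl)
      evalA-coincidence ρ ρ′ ainf h = refl
      evalA-coincidence ρ ρ′ asup h = refl
      evalA-coincidence ρ ρ′ (afun f as) h = cong (pfun f) (evalAs-coincidence ρ ρ′ as h)
      evalA-coincidence ρ ρ′ (aagg α Xs F) h = aggFun-ext α _ _ λ u → mk⇔
        (λ (l , s) → l , sat-coincidence _ _ F (agree-updates ρ ρ′ (toList Xs) (fvF F) h u l) s)
        (λ (l , s) → l , sat-coincidence _ _ F
                            (agree-updates ρ′ ρ (toList Xs) (fvF F) (λ X m → ≡-sym (h X m)) u l) s)

      evalAs-coincidence : ∀ ρ ρ′ as → Agree ρ ρ′ (fvAs as) → evalAs ρ as ≡ evalAs ρ′ as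
      evalAs-coincidence ρ ρ′ [] h = refl
      evalAs-coincidence ρ ρ′ (a ∷ as) h =
        cong₂ _∷_ (evalA-coincidence ρ ρ′ a (λ X m → h X (∈-++⁺ˡ m)))
                  (evalAs-coincidence ρ ρ′ as (λ X m → h X (∈-++⁺ʳ (fvA a) m)))

      sat-coincidence : ∀ ρ ρ′ F → Agree ρ ρ′ (fvF F) → sat ρ F → sat ρ′ F
      sat-coincidence ρ ρ′ (fatom p as) h s = subst (I p) (evalAs-coincidence ρ ρ′ as h) s
      sat-coincidence ρ ρ′ (fcmp ≺ a b) h s =
        subst₂ (relHolds ≺) (evalA-coincidence ρ ρ′ a (λ X m → h X (∈-++⁺ˡ m)))
                            (evalA-coincidence ρ ρ′ b (λ X m → h X (∈-++⁺ʳ (fvA a) m))) s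
      sat-coincidence ρ ρ′ (fin a t) h s =
        subst₂ ⟦_⟧ (groundT-cong ρ ρ′ t (λ x m → h (pv x) (∈-++⁺ʳ (fvA a) (∈-map⁺ pv m))))
                   (evalA-coincidence ρ ρ′ a (λ X m → h X (∈-++⁺ˡ m))) s
      sat-coincidence ρ ρ′ f⊥ h s = s
      sat-coincidence ρ ρ′ (F ⟶ G) h s f =
        sat-coincidence ρ ρ′ G (λ X m → h X (∈-++⁺ʳ (fvF F) m))
          (s (sat-coincidence ρ′ ρ F (λ X m → ≡-sym (h X (∈-++⁺ˡ m))) f))
      sat-coincidence ρ ρ′ (fall X F) h s r =
        sat-coincidence (update ρ X r) (update ρ′ X r) F
          (agree-updates ρ ρ′ (X ∷ []) (fvF F) h (r ∷ []) refl) (s r)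

module Correctness (S : Sig) (C : Ctx S) (em : ExcludedMiddle (lsuc 0ℓ)) (I : Syntax.Interp S) where
  open Sig S
  open Syntax S
  open Ctx C
  open Semantics S C
  open FO I
  open TermProperties S
  open EnvironmentProperties S C
  open Coincidence I

  decide : (P : Set) → Dec P
  decide P = map′ lower lift em

  ¬¬-elim : {P : Set} → ¬ ¬ P → P
  ¬¬-elim = decidable-stable (decide _)

  -- Classical connectives
  sat-∧ : ∀ ρ F G → sat ρ (F f∧ G) ⇔ (sat ρ F × sat ρ G)
  sat-∧ ρ F G = mk⇔ (λ h → ¬¬-elim (λ ¬f → h (λ f _ → ¬f f)) , ¬¬-elim (λ ¬g → h (λ _ g → ¬g g)))
                    (λ (f , g) k → k f g)

  sat-∨ : ∀ ρ F G → sat ρ (F f∨ G) ⇔ (sat ρ F ⊎ sat ρ G)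
  sat-∨ ρ F G = mk⇔ (λ h → case (decide (sat ρ F)) h) λ { (inj₁ f) ¬f → ⊥-elim (¬f f) ; (inj₂ g) _ → g }
    where
      case : Dec (sat ρ F) → sat ρ (F f∨ G) → sat ρ F ⊎ sat ρ G
      case (yes f) _ = inj₁ f
      case (no ¬f) h = inj₂ (h ¬f)

  sat-↔ : ∀ ρ F G → sat ρ (F f↔ G) ⇔ (sat ρ F ⇔ sat ρ G)
  sat-↔ ρ F G = mk⇔ (λ h → let (f⇒g , g⇒f) = to (sat-∧ ρ (F ⟶ G) (G ⟶ F)) h in mk⇔ f⇒g g⇒f)
                    (λ e → from (sat-∧ ρ (F ⟶ G) (G ⟶ F)) (to e , from e))

  sat-∃ : ∀ ρ X F → sat ρ (fex X F) ⇔ Σ PTerm (λ r → sat (update ρ X r) F)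
  sat-∃ ρ X F = mk⇔ (λ h → ¬¬-elim (λ ¬∃ → h (λ r s → ¬∃ (r , s)))) (λ (r , s) k → k r s)

  sat-∀* : ∀ ρ Xs F → sat ρ (fall* Xs F) ⇔
             ((rs : List PTerm) → length rs ≡ length Xs → sat (updates ρ Xs rs) F)
  sat-∀* ρ [] F = mk⇔ (λ { h [] refl → h }) (λ h → h [] refl)
  sat-∀* ρ (X ∷ Xs) F = mk⇔
    (λ { h [] () ; h (r ∷ rs) l → to (sat-∀* (update ρ X r) Xs F) (h r) rs (suc-injective l) })
    (λ h r → from (sat-∀* (update ρ X r) Xs F) (λ rs l → h (r ∷ rs) (cong suc l)))

  sat-∃* : ∀ ρ Xs F → sat ρ (fex* Xs F) ⇔
             Σ (List PTerm) (λ rs → length rs ≡ length Xs × sat (updates ρ Xs rs) F)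
  sat-∃* ρ [] F = mk⇔ (λ h → [] , refl , h) (λ { ([] , refl , h) → h })
  sat-∃* ρ (X ∷ Xs) F = mk⇔
    (λ h → let r , h′ = to (sat-∃ ρ X (fex* Xs F)) h
               rs , l , s = to (sat-∃* (update ρ X r) Xs F) h′
           in r ∷ rs , cong suc l , s)
    (λ { ([] , () , _)
       ; (r ∷ rs , l , s) → from (sat-∃ ρ X (fex* Xs F))
                              (r , from (sat-∃* (update ρ X r) Xs F) (rs , suc-injective l , s)) })

  sat-bigAnd : ∀ ρ Fs → sat ρ (bigAnd Fs) ⇔ All (sat ρ) Fs
  sat-bigAnd ρ Fs = mk⇔ (bigAnd⁻ Fs) (bigAnd⁺ Fs)
    where
      bigAnd⁻ : ∀ Fs → sat ρ (bigAnd Fs) → All (sat ρ) Fs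
      bigAnd⁻ [] _ = []
      bigAnd⁻ (F ∷ []) f = f ∷ []
      bigAnd⁻ (F ∷ G ∷ Fs) h = let f , fs = to (sat-∧ ρ F (bigAnd (G ∷ Fs))) h in f ∷ bigAnd⁻ (G ∷ Fs) fs

      bigAnd⁺ : ∀ Fs → All (sat ρ) Fs → sat ρ (bigAnd Fs)
      bigAnd⁺ [] _ = λ z → z
      bigAnd⁺ (F ∷ []) (f ∷ []) = f
      bigAnd⁺ (F ∷ G ∷ Fs) (f ∷ fs) = from (sat-∧ ρ F (bigAnd (G ∷ Fs))) (f , bigAnd⁺ (G ∷ Fs) fs)

  sat-bigOr : ∀ ρ Fs → sat ρ (bigOr Fs) ⇔ Any (sat ρ) Fs
  sat-bigOr ρ Fs = mk⇔ (bigOr⁻ Fs) (bigOr⁺ Fs)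
    where
      bigOr⁻ : ∀ Fs → sat ρ (bigOr Fs) → Any (sat ρ) Fs
      bigOr⁻ (F ∷ []) f = here f
      bigOr⁻ (F ∷ G ∷ Fs) h =
        [ here , (λ g → there (bigOr⁻ (G ∷ Fs) g)) ]′ (to (sat-∨ ρ F (bigOr (G ∷ Fs))) h)

      bigOr⁺ : ∀ Fs → Any (sat ρ) Fs → sat ρ (bigOr Fs)
      bigOr⁺ (F ∷ []) (here f) = f
      bigOr⁺ (F ∷ G ∷ Fs) (here f) = from (sat-∨ ρ F (bigOr (G ∷ Fs))) (inj₁ f)
      bigOr⁺ (F ∷ G ∷ Fs) (there a) = from (sat-∨ ρ F (bigOr (G ∷ Fs))) (inj₂ (bigOr⁺ (G ∷ Fs) a))

  -- Literals
  Grounds : Subst → Env → List Var → Set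
  Grounds θ ρ xs = ∀ x → x ∈ xs → θ x ≡ groundSubst ρ x

  LitHolds : CLit → Set
  LitHolds (atomL p ts) = Σ (List PTerm) λ rs → ⟦ ts ⟧ˢ rs × I p rs
  LitHolds (notL p ts) = Σ (List PTerm) λ rs → ⟦ ts ⟧ˢ rs × ¬ I p rs
  LitHolds (cmpL ≺ t₁ t₂) = Σ PTerm λ r₁ → Σ PTerm λ r₂ → ⟦ t₁ ⟧ r₁ × ⟦ t₂ ⟧ r₂ × relHolds ≺ r₁ r₂

  ⊨τL⇔LitHolds : ∀ l → I ⊨ᵢ τL l ⇔ LitHolds l
  ⊨τL⇔LitHolds (atomL p ts) = mk⇔ (λ { (lift (rs , m) , lift i) → rs , m , i })
                                  (λ { (rs , m , i) → lift (rs , m) , lift i })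
  ⊨τL⇔LitHolds (notL p ts) = mk⇔ (λ { (lift (rs , m) , ¬i) → rs , m , (λ i → lower (¬i (lift i))) })
                                 (λ { (rs , m , ¬i) → lift (rs , m) , (λ i → lift (¬i (lower i))) })
  ⊨τL⇔LitHolds (cmpL ≺ t₁ t₂) = mk⇔ (λ { (lift w , _) → w }) (λ w → lift w , (λ z → z))

  ⊨τC⇔All : ∀ Cs → I ⊨ᵢ τC Cs ⇔ All LitHolds Cs
  ⊨τC⇔All Cs = mk⇔ (τC⁻ Cs) (τC⁺ Cs)
    where
      τC⁻ : ∀ Cs → I ⊨ᵢ τC Cs → All LitHolds Cs
      τC⁻ [] h = []
      τC⁻ (C ∷ Cs) h = to (⊨τL⇔LitHolds C) (h (lift Fin.zero)) ∷ τC⁻ Cs (λ j → h (lift (Fin.suc (lower j))))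

      τC⁺ : ∀ Cs → All LitHolds Cs → I ⊨ᵢ τC Cs
      τC⁺ (C ∷ Cs) (c ∷ cs) (lift Fin.zero) = from (⊨τL⇔LitHolds C) c
      τC⁺ (C ∷ Cs) (c ∷ cs) (lift (Fin.suc i)) = τC⁺ Cs cs (lift i)

  evalAs-avar : ∀ ρ Xs → evalAs ρ (L.map avar Xs) ≡ L.map ρ Xs
  evalAs-avar ρ [] = refl
  evalAs-avar ρ (X ∷ Xs) = cong (ρ X ∷_) (evalAs-avar ρ Xs)

  sat-∈* : ∀ ρ Xs ts → length Xs ≡ length ts →
           sat ρ (Xs ∈* ts) ⇔ ⟦ substTs (groundSubst ρ) ts ⟧ˢ (L.map ρ Xs)
  sat-∈* ρ Xs ts l = mk⇔ (λ s → ∈*⁻ Xs ts l (to (sat-bigAnd ρ _) s))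
                         (λ s → from (sat-bigAnd ρ _) (∈*⁺ Xs ts l s))
    where
      Memberships : List FVar → List Term → List Form
      Memberships Xs ts = L.zipWith (λ X t → fin (avar X) t) Xs ts

      ∈*⁻ : ∀ Xs ts → length Xs ≡ length ts → All (sat ρ) (Memberships Xs ts) →
            ⟦ substTs (groundSubst ρ) ts ⟧ˢ (L.map ρ Xs)
      ∈*⁻ [] [] _ _ = _
      ∈*⁻ (X ∷ Xs) (t ∷ ts) l (s ∷ ss) = s , ∈*⁻ Xs ts (suc-injective l) ss

      ∈*⁺ : ∀ Xs ts → length Xs ≡ length ts →
            ⟦ substTs (groundSubst ρ) ts ⟧ˢ (L.map ρ Xs) → All (sat ρ) (Memberships Xs ts)
      ∈*⁺ [] [] _ _ = []
      ∈*⁺ (X ∷ Xs) (t ∷ ts) l (s , ss) = s ∷ ∈*⁺ Xs ts (suc-injective l) ss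

  sat-fresh-∈* : ∀ ts n ρ θ → Grounds θ ρ (varsTs ts) → ∀ rs → length rs ≡ length ts →
    let Xs = news n (length ts) in
    (sat (updates ρ Xs rs) (Xs ∈* ts) ⇔ ⟦ substTs θ ts ⟧ˢ rs) × (L.map (updates ρ Xs rs) Xs ≡ rs)
  sat-fresh-∈* ts n ρ θ h rs l =
    subst₂ (λ ts′ rs′ → sat ρ′ (Xs ∈* ts) ⇔ ⟦ ts′ ⟧ˢ rs′) ts≡ Xs≡
           (sat-∈* ρ′ Xs ts (length-news n (length ts))) ,
    Xs≡
    where
      Xs = news n (length ts)
      ρ′ = updates ρ Xs rs
      Xs≡ : L.map ρ′ Xs ≡ rs
      Xs≡ = map-updates ρ Xs rs (news-unique n (length ts)) (trans l (≡-sym (length-news n (length ts))))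
      ts≡ : substTs (groundSubst ρ′) ts ≡ substTs θ ts
      ts≡ = substTs-cong _ _ ts λ x m →
              trans (cong just (updates-∉ ρ Xs rs (pv x) (pv∉news x n (length ts)))) (≡-sym (h x m))

  sat-∃-fresh-∈* : ∀ ts n ρ θ → Grounds θ ρ (varsTs ts) → (G : Form) (P : List PTerm → Set) →
    let Xs = news n (length ts) in
    (∀ rs → length rs ≡ length ts → sat (updates ρ Xs rs) G ⇔ P rs) →
    sat ρ (fex* Xs (Xs ∈* ts f∧ G)) ⇔ Σ (List PTerm) λ rs → ⟦ substTs θ ts ⟧ˢ rs × P rs
  sat-∃-fresh-∈* ts n ρ θ h G P G⇔P = mk⇔
    (λ s → let rs , l , s′ = to (sat-∃* ρ Xs (Xs ∈* ts f∧ G)) s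
               m , g = to (sat-∧ _ (Xs ∈* ts) G) s′
               l′ = trans l (length-news n (length ts))
           in rs , to (proj₁ (sat-fresh-∈* ts n ρ θ h rs l′)) m , to (G⇔P rs l′) g)
    (λ (rs , m , p) →
       let l′ = trans (⟦⟧ˢ-length _ rs m) (length-substTs θ ts)
       in from (sat-∃* ρ Xs (Xs ∈* ts f∧ G))
            (rs , trans l′ (≡-sym (length-news n (length ts))) ,
             from (sat-∧ _ (Xs ∈* ts) G)
               (from (proj₁ (sat-fresh-∈* ts n ρ θ h rs l′)) m , from (G⇔P rs l′) p)))
    where
      Xs = news n (length ts)

  φL-correct : ∀ l n ρ θ → Grounds θ ρ (varsL l) → sat ρ (proj₁ (φL l n)) ⇔ LitHolds (substL θ l)
  φL-correct (atomL p ts) n ρ θ h = sat-∃-fresh-∈* ts n ρ θ h _ (I p) λ rs l →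
    ≡⇒⇔ (cong (I p) (trans (evalAs-avar _ _) (proj₂ (sat-fresh-∈* ts n ρ θ h rs l))))
  φL-correct (notL p ts) n ρ θ h = sat-∃-fresh-∈* ts n ρ θ h _ (λ rs → ¬ I p rs) λ rs l →
    ≡⇒⇔ (cong (λ rs → ¬ I p rs) (trans (evalAs-avar _ _) (proj₂ (sat-fresh-∈* ts n ρ θ h rs l))))
  φL-correct (cmpL ≺ t₁ t₂) n ρ θ h =
    ⇔.trans (sat-∃ ρ X₁ (fex X₂ Body)) (∃-⇔ λ r₁ →
    ⇔.trans (sat-∃ (update ρ X₁ r₁) X₂ Body) (∃-⇔ λ r₂ →
    ⇔.trans (sat-∧ (ρ₂ r₁ r₂) M₁ (M₂ f∧ Cmp))
      (≡⇒⇔ (cong₂ ⟦_⟧ (t₁≡ r₁ r₂) (X₁↦ r₁ r₂)) ×-⇔ ⇔.trans (sat-∧ (ρ₂ r₁ r₂) M₂ Cmp)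
        (≡⇒⇔ (cong₂ ⟦_⟧ (t₂≡ r₁ r₂) (X₂↦ r₁ r₂)) ×-⇔ ≡⇒⇔ (cong₂ (relHolds ≺) (X₁↦ r₁ r₂) (X₂↦ r₁ r₂))))))
    where
      X₁ = nv n
      X₂ = nv (suc n)
      M₁ = fin (avar X₁) t₁
      M₂ = fin (avar X₂) t₂
      Cmp = fcmp ≺ (avar X₁) (avar X₂)
      Body = M₁ f∧ (M₂ f∧ Cmp)
      ρ₂ : PTerm → PTerm → Env
      ρ₂ r₁ r₂ = update (update ρ X₁ r₁) X₂ r₂
      X₁↦ : ∀ r₁ r₂ → ρ₂ r₁ r₂ X₁ ≡ r₁
      X₁↦ r₁ r₂ = trans (update-≢ (update ρ X₁ r₁) X₂ r₂ X₁ λ ()) (update-≡ ρ X₁ r₁)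
      X₂↦ : ∀ r₁ r₂ → ρ₂ r₁ r₂ X₂ ≡ r₂
      X₂↦ r₁ r₂ = update-≡ (update ρ X₁ r₁) X₂ r₂
      t₁≡ : ∀ r₁ r₂ → groundT (ρ₂ r₁ r₂) t₁ ≡ substT θ t₁
      t₁≡ r₁ r₂ = substT-cong _ _ t₁ (λ x m → ≡-sym (h x (∈-++⁺ˡ m)))
      t₂≡ : ∀ r₁ r₂ → groundT (ρ₂ r₁ r₂) t₂ ≡ substT θ t₂
      t₂≡ r₁ r₂ = substT-cong _ _ t₂ (λ x m → ≡-sym (h x (∈-++⁺ʳ (varsT t₁) m)))

  φLs-correct : ∀ Cs n ρ θ → Grounds θ ρ (concatMap varsL Cs) →
                All (sat ρ) (proj₁ (φLs Cs n)) ⇔ All LitHolds (L.map (substL θ) Cs)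
  φLs-correct [] n ρ θ h = mk⇔ (λ _ → []) (λ _ → [])
  φLs-correct (C ∷ Cs) n ρ θ h = mk⇔
    (λ { (c ∷ cs) → to first c ∷ to rest cs })
    (λ { (c ∷ cs) → from first c ∷ from rest cs })
    where
      first = φL-correct C n ρ θ (λ x m → h x (∈-++⁺ˡ m))
      rest = φLs-correct Cs (proj₂ (φL C n)) ρ θ (λ x m → h x (∈-++⁺ʳ (varsL C) m))

  -- Aggregate expressions
  module AggregateTuples (ts : List⁺ Term) (Cs : List CLit) where
    Y : List Var
    Y = deduplicate ℕ._≟_ (varsTs (toList ts) ++ concatMap varsL Cs)

    Tuple : Set
    Tuple = Vec PTerm (length Y)

    bind : Tuple → Subst
    bind r = bindVars Y (V.toList r)

    Satisfied : Tuple → Set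
    Satisfied r = All LitHolds (L.map (substL (bind r)) Cs)

    values : (Tuple → Set) → List PTerm → Set
    values Δ u = Σ Tuple λ r → Δ r × ⟦ substTs (bind r) (toList ts) ⟧ˢ u

  -- The conjunct of τ for a non-justifying Δ can fail only when Δ is exactly the set of
  -- satisfied tuples.
  ⊨τAgg⇔justified : ∀ α ts Cs ≺ s → let open AggregateTuples ts Cs in
    I ⊨ᵢ τAgg α ts Cs ≺ s ⇔ Σ PTerm (λ v → boundVal s v × relHolds ≺ (aggFun α (values Satisfied)) v)
  ⊨τAgg⇔justified α ts Cs ≺ s = mk⇔ τ⇒justified justified⇒τ
    where
      open AggregateTuples ts Cs
      Justifies : (Tuple → Set) → Set
      Justifies Δ = Σ PTerm λ v → boundVal s v × relHolds ≺ (aggFun α (values Δ)) v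

      τ⇒justified : I ⊨ᵢ τAgg α ts Cs ≺ s → Justifies Satisfied
      τ⇒justified h with decide (Justifies Satisfied)
      ... | yes j = j
      ... | no ¬j with h (Satisfied , ¬j) (λ r → from (⊨τC⇔All _) (proj₂ (lower r)))
      ...   | lift (r , r∉Δ) , τr = ⊥-elim (r∉Δ (to (⊨τC⇔All _) τr))

      justified⇒τ : Justifies Satisfied → I ⊨ᵢ τAgg α ts Cs ≺ s
      justified⇒τ (v , b , rel) (Δ , ¬j) Δ⊆ with decide (Σ Tuple λ r → ¬ Δ r × Satisfied r)
      ... | yes (r , r∉Δ , sat-r) = lift (r , r∉Δ) , from (⊨τC⇔All _) sat-r
      ... | no Satisfied⊆Δ = ⊥-elim (¬j (v , b , subst (λ a → relHolds ≺ a v) (≡-sym same-value) rel))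
        where
          Δ⇔Satisfied : ∀ r → Δ r ⇔ Satisfied r
          Δ⇔Satisfied r = mk⇔ (λ d → to (⊨τC⇔All _) (Δ⊆ (lift (r , d))))
                              (λ d → ¬¬-elim (λ r∉Δ → Satisfied⊆Δ (r , r∉Δ , d)))
          same-value : aggFun α (values Δ) ≡ aggFun α (values Satisfied)
          same-value = aggFun-ext α _ _ λ u →
            mk⇔ (λ (r , d , m) → r , to (Δ⇔Satisfied r) d , m)
                (λ (r , d , m) → r , from (Δ⇔Satisfied r) d , m)

  GroundsOutside : List Var → Subst → Env → Var → Set
  GroundsOutside X θ ρ x = (θ x ≡ groundSubst ρ x × x ∉ X) ⊎ (θ x ≡ nothing × x ∈ X)

  module Comprehension (X : List Var) (t₀ : Term) (ts₀ : List Term) (Cs : List CLit) (n : ℕ)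
    (ρ : Env) (θ : Subst) (θ≈ρ : ∀ x → x ∈ varsTs (t₀ ∷ ts₀) ++ concatMap varsL Cs → GroundsOutside X θ ρ x)
    where

    ts : List Term
    ts = t₀ ∷ ts₀

    Z : List FVar
    Z = nv n ∷ news (suc n) (length ts₀)

    Fs : List Form
    Fs = proj₁ (φLs Cs (suc (n + length ts)))

    Body : Form
    Body = Z ∈* ts f∧ bigAnd Fs

    open AggregateTuples (L⁺.map (substT θ) (t₀ ∷ ts₀)) (L.map (substL θ) Cs)

    env : List PTerm → List PTerm → Env
    env u w = updates (updates ρ Z u) (L.map pv X) w

    Z-unique : Unique Z
    Z-unique = All.tabulate (λ { m refl → n≮n n (news-≥ n (suc n) (length ts₀) m) })
               AllPairs.∷ news-unique (suc n) (length ts₀)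

    length-Z : length Z ≡ length ts
    length-Z = cong suc (length-news (suc n) (length ts₀))

    pv∉Z : ∀ x → pv x ∉ Z
    pv∉Z x (there m) = pv∉news x (suc n) (length ts₀) m

    θts : List Term
    θts = toList (L⁺.map (substT θ) (t₀ ∷ ts₀))

    θts≡ : θts ≡ substTs θ ts
    θts≡ = ≡-sym (substTs≡map θ ts)

    env-global : ∀ u w x → x ∉ X → env u w (pv x) ≡ ρ (pv x)
    env-global u w x x∉X = trans (updates-∉ _ (L.map pv X) w (pv x) (λ m → x∉X (pv-∈-map x X m)))
                                 (updates-∉ ρ Z u (pv x) (pv∉Z x))

    map-env-Z : ∀ u w → length u ≡ length Z → L.map (env u w) Z ≡ u
    map-env-Z u w l =
      trans (map-cong-local (All.tabulate λ {Y} mZ → updates-∉ _ (L.map pv X) w Y (nv∉X Y mZ)))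
            (map-updates ρ Z u Z-unique l)
      where
        nv∉X : ∀ Y → Y ∈ Z → Y ∉ L.map pv X
        nv∉X Y mZ mX with ∈-map⁻ pv mX
        ... | y , _ , refl = pv∉Z y mZ

    free⇒∈Y : ∀ x → x ∈ varsTs ts ++ concatMap varsL Cs → θ x ≡ nothing → x ∈ Y
    free⇒∈Y x m e with ∈-++⁻ (varsTs ts) m
    ... | inj₁ m₁ = ∈-deduplicate⁺ ℕ._≟_ (∈-++⁺ˡ (subst (λ z → x ∈ varsTs z) (≡-sym θts≡)
                                                     (∈-varsTs-substTs θ x ts m₁ e)))
    ... | inj₂ m₂ = ∈-deduplicate⁺ ℕ._≟_ (∈-++⁺ʳ (varsTs θts)
                                                     (∈-varsLs-substLs θ x Cs m₂ e))

    ⊕-grounds : ∀ u w σ₂ → (∀ x → x ∈ X → x ∈ Y → σ₂ x ≡ groundSubst (env u w) x) →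
                Grounds (θ ⊕ σ₂) (env u w) (varsTs ts ++ concatMap varsL Cs)
    ⊕-grounds u w σ₂ h x m with θ≈ρ x m
    ... | inj₁ (e , x∉X) = trans (cong (_<∣> σ₂ x) e) (cong just (≡-sym (env-global u w x x∉X)))
    ... | inj₂ (e , x∈X) = trans (cong (_<∣> σ₂ x) e) (h x x∈X (free⇒∈Y x m e))

    sat-Body : ∀ u w σ₂ → length u ≡ length Z → Grounds (θ ⊕ σ₂) (env u w) (varsTs ts ++ concatMap varsL Cs) →
               sat (env u w) Body ⇔
                 (⟦ substTs σ₂ θts ⟧ˢ u × All LitHolds (L.map (substL σ₂) (L.map (substL θ) Cs)))
    sat-Body u w σ₂ l g = ⇔.trans (sat-∧ _ (Z ∈* ts) (bigAnd Fs))
      (subst₂ (λ ts′ u′ → sat (env u w) (Z ∈* ts) ⇔ ⟦ ts′ ⟧ˢ u′) ts≡ (map-env-Z u w l)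
              (sat-∈* _ Z ts length-Z) ×-⇔
       ⇔.trans (sat-bigAnd _ Fs)
         (subst (λ Cs′ → All (sat (env u w)) Fs ⇔ All LitHolds Cs′) (≡-sym (map-substL-⊕ θ σ₂ Cs))
           (φLs-correct Cs _ (env u w) (θ ⊕ σ₂) (λ x m → g x (∈-++⁺ʳ (varsTs ts) m)))))
      where
        ts≡ : substTs (groundSubst (env u w)) ts ≡ substTs σ₂ θts
        ts≡ = trans (substTs-cong _ _ ts (λ x m → ≡-sym (g x (∈-++⁺ˡ m))))
                    (trans (≡-sym (substTs-⊕ θ σ₂ ts)) (cong (substTs σ₂) (≡-sym θts≡)))

    Comprehended : List PTerm → Set
    Comprehended u = length u ≡ length Z × sat (updates ρ Z u) (fex* (L.map pv X) Body)

    -- A value list w for the local variables gives the tuple r that reads w on Y, and a tuple r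
    -- gives w reading r on X (arbitrarily pinf off Y); either way they agree on X ∩ Y.
    comprehension-correct : ∀ u → Comprehended u ⇔ values Satisfied u
    comprehension-correct u = mk⇔ comprehension⇒values values⇒comprehension
      where
        comprehension⇒values : Comprehended u → values Satisfied u
        comprehension⇒values (l , s) =
          let w , _ , s′ = to (sat-∃* _ (L.map pv X) Body) s
              g : Var → PTerm
              g y = env u w (pv y)
              r = V.map g (V.fromList Y)
              r≡ : V.toList r ≡ L.map g Y
              r≡ = trans (toList-map g (V.fromList Y)) (cong (L.map g) (toList∘fromList Y))
              bind-r : ∀ x → x ∈ X → x ∈ Y → bind r x ≡ just (g x)
              bind-r x _ x∈Y = trans (cong (λ z → bindVars Y z x) r≡) (bindVars-map g Y x x∈Y)
              m , c = to (sat-Body u w (bind r) l (⊕-grounds u w (bind r) bind-r)) s′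
          in r , c , m

        values⇒comprehension : values Satisfied u → Comprehended u
        values⇒comprehension (r , c , m) =
          l , from (sat-∃* _ (L.map pv X) Body)
                (w , length-map g (L.map pv X) ,
                 from (sat-Body u w (bind r) l (⊕-grounds u w (bind r) bind-r)) (m , c))
          where
            g : FVar → PTerm
            g (pv x) = fromMaybe pinf (bind r x)
            g (nv _) = pinf
            w = L.map g (L.map pv X)
            bind-r : ∀ x → x ∈ X → x ∈ Y → bind r x ≡ groundSubst (env u w) x
            bind-r x x∈X x∈Y =
              let v , e = bindVars-defined Y (V.toList r) x x∈Y (length-toList r)
              in trans e (cong just (≡-sym (trans (updates-map _ g (L.map pv X) (pv x) (∈-map⁺ pv x∈X))
                                                 (cong (fromMaybe pinf) e))))
            l : length u ≡ length Z
            l = trans (⟦⟧ˢ-length _ u m)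
                  (trans (length-substTs (bind r) θts)
                    (trans (cong length θts≡) (trans (length-substTs θ ts) (≡-sym length-Z))))

  ⟦boundTerm⟧⇔boundVal : ∀ s ρ θ → Grounds θ ρ (varsB s) → ∀ v →
                         ⟦ groundT ρ (boundTerm s) ⟧ v ⇔ boundVal (substB θ s) v
  ⟦boundTerm⟧⇔boundVal (bval r) ρ θ h v rewrite substT-embed (groundSubst ρ) r = ⟦embed⟧⇔≡ r v
  ⟦boundTerm⟧⇔boundVal (bvar x) ρ θ h v rewrite substB-bvar θ x (ρ (pv x)) (h x (here refl)) =
    ⟦embed⟧⇔≡ (ρ (pv x)) v

  φAgg-correct : ∀ X α ts Cs ≺ s n ρ θ → Grounds θ ρ (varsB s) →
    (∀ x → x ∈ varsTs (toList ts) ++ concatMap varsL Cs → GroundsOutside X θ ρ x) →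
    sat ρ (proj₁ (φE X (agg α ts Cs ≺ s) n)) ⇔ I ⊨ᵢ τE (substE θ (agg α ts Cs ≺ s))
  φAgg-correct X α (t₀ ∷ ts₀) Cs ≺ s n ρ θ hs hc =
    ⇔.trans (sat-∃ ρ Yv (Cmp f∧ InS)) (⇔.trans (∃-⇔ λ v →
      ⇔.trans (sat-∧ (ρ-Yv v) Cmp InS) (⇔.trans (compared v ×-⇔ bound v) (mk⇔ swap swap)))
    (⇔.sym (⊨τAgg⇔justified α (L⁺.map (substT θ) ts) (L.map (substL θ) Cs) ≺ (substB θ s))))
    where
      ts = t₀ ∷ ts₀
      Yv = nv (n + length (toList ts))
      Comp = fex* (L.map pv X) (Comprehension.Body X t₀ ts₀ Cs n ρ θ hc)
      Cmp = fcmp ≺ (aagg α (news⁺ n ts) Comp) (avar Yv)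
      InS = fin (avar Yv) (boundTerm s)
      open AggregateTuples (L⁺.map (substT θ) ts) (L.map (substL θ) Cs)
      ρ-Yv : PTerm → Env
      ρ-Yv v = update ρ Yv v
      compared : ∀ v → sat (ρ-Yv v) Cmp ⇔ relHolds ≺ (aggFun α (values Satisfied)) v
      compared v = ≡⇒⇔ (cong₂ (relHolds ≺)
        (aggFun-ext α _ _ (Comprehension.comprehension-correct X t₀ ts₀ Cs n (ρ-Yv v) θ hc)) (update-≡ ρ Yv v))
      bound : ∀ v → sat (ρ-Yv v) InS ⇔ boundVal (substB θ s) v
      bound v = ⇔.trans (≡⇒⇔ (cong ⟦ groundT (ρ-Yv v) (boundTerm s) ⟧ (update-≡ ρ Yv v)))
                        (⟦boundTerm⟧⇔boundVal s (ρ-Yv v) θ hs v)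

  ElemGrounds : List Var → Subst → Env → BodyElem → Set
  ElemGrounds X θ ρ B = Grounds θ ρ (outerVarsE B) × (∀ x → x ∈ innerVarsE B → GroundsOutside X θ ρ x)

  φE-correct : ∀ X B n ρ θ → ElemGrounds X θ ρ B → sat ρ (proj₁ (φE X B n)) ⇔ I ⊨ᵢ τE (substE θ B)
  φE-correct X (lit l) n ρ θ (ho , _) = ⇔.trans (φL-correct l n ρ θ ho) (⇔.sym (⊨τL⇔LitHolds (substL θ l)))
  φE-correct X (agg α ts Cs ≺ s) n ρ θ (ho , hi) = φAgg-correct X α ts Cs ≺ s n ρ θ ho hi

  φBody-correct : ∀ X b n ρ θ → (∀ B → B ∈ b → ElemGrounds X θ ρ B) →
                  All (sat ρ) (proj₁ (φBody X b n)) ⇔ I ⊨ᵢ τBody (L.map (substE θ) b)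
  φBody-correct X b n ρ θ h = mk⇔ (φBody⁻ b n h) (φBody⁺ b n h)
    where
      φBody⁻ : ∀ b n → (∀ B → B ∈ b → ElemGrounds X θ ρ B) →
               All (sat ρ) (proj₁ (φBody X b n)) → I ⊨ᵢ τBody (L.map (substE θ) b)
      φBody⁻ (B ∷ b) n h (s ∷ _) (lift Fin.zero) = to (φE-correct X B n ρ θ (h B (here refl))) s
      φBody⁻ (B ∷ b) n h (_ ∷ ss) (lift (Fin.suc i)) =
        φBody⁻ b (proj₂ (φE X B n)) (λ B′ m → h B′ (there m)) ss (lift i)

      φBody⁺ : ∀ b n → (∀ B → B ∈ b → ElemGrounds X θ ρ B) →
               I ⊨ᵢ τBody (L.map (substE θ) b) → All (sat ρ) (proj₁ (φBody X b n))
      φBody⁺ [] n h t = []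
      φBody⁺ (B ∷ b) n h t =
        from (φE-correct X B n ρ θ (h B (here refl))) (t (lift Fin.zero))
        ∷ φBody⁺ b (proj₂ (φE X B n)) (λ B′ m → h B′ (there m)) (λ j → t (lift (Fin.suc (lower j))))

  -- Rules and completions
  ∃-closure : List FVar → Form → Form
  ∃-closure V F = fex* (deduplicate _≟F_ (removeF V (fvF F))) F

  ∉-∃-closure : ∀ V F Y → Y ∈ V → Y ∉ deduplicate _≟F_ (removeF V (fvF F))
  ∉-∃-closure V F Y Y∈V m =
    proj₂ (∈-filter⁻ (λ y → ¬? (y ∈F? V)) {xs = fvF F} (∈-deduplicate⁻ _≟F_ (removeF V (fvF F)) m)) Y∈V

  ∃-closure-elim : ∀ V F ρ → sat ρ (∃-closure V F) → Σ Env λ ρ′ → Agree ρ′ ρ V × sat ρ′ F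
  ∃-closure-elim V F ρ s =
    let u , _ , s′ = to (sat-∃* ρ U F) s
    in updates ρ U u , (λ Y Y∈V → updates-∉ ρ U u Y (∉-∃-closure V F Y Y∈V)) , s′
    where U = deduplicate _≟F_ (removeF V (fvF F))

  ∃-closure-intro : ∀ V F ρ ρ′ → Agree ρ′ ρ V → sat ρ′ F → sat ρ (∃-closure V F)
  ∃-closure-intro V F ρ ρ′ h s =
    from (sat-∃* ρ U F) (L.map ρ′ U , length-map ρ′ U , sat-coincidence ρ′ _ F agree s)
    where
      U = deduplicate _≟F_ (removeF V (fvF F))
      agree : Agree ρ′ (updates ρ U (L.map ρ′ U)) (fvF F)
      agree Y m with Y ∈F? V
      ... | yes Y∈V = trans (h Y Y∈V) (≡-sym (updates-∉ ρ U _ Y (∉-∃-closure V F Y Y∈V)))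
      ... | no Y∉V =
        ≡-sym (updates-map ρ ρ′ U Y (∈-deduplicate⁺ _≟F_ (∈-filter⁺ (λ y → ¬? (y ∈F? V)) m Y∉V)))

  withGlobals : (Var → PTerm) → Env → Env
  withGlobals σ ρ (pv x) = σ x
  withGlobals σ ρ (nv i) = ρ (nv i)

  withGlobals-news : ∀ σ ρ n k → Agree (withGlobals σ ρ) ρ (news n k)
  withGlobals-news σ ρ n k Y m with ∈-map⁻ (λ i → nv (n + i)) m
  ... | _ , _ , refl = refl

  body-grounds : ∀ R ρ B → B ∈ body R → ElemGrounds (localVars R) (instanceSubst R (globalsOf ρ)) ρ B
  body-grounds R ρ B B∈R =
    (λ x m → instanceSubst-global R (globalsOf ρ) x (outer-var-global R B x B∈R m)) ,
    (λ x m → inner x m (x ∈ℕ? globalVars R))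
    where
      inner : ∀ x → x ∈ innerVarsE B → Dec (x ∈ globalVars R) →
              GroundsOutside (localVars R) (instanceSubst R (globalsOf ρ)) ρ x
      inner x m (yes g) = inj₁ (instanceSubst-global R (globalsOf ρ) x g , (λ l → local⇒¬global R x l g))
      inner x m (no ¬g) = inj₂ (instanceSubst-local R (globalsOf ρ) x ¬g , inner-var-local R B x B∈R m ¬g)

  sat-ruleBody : ∀ R n ρ → sat ρ (bigAnd (proj₁ (φBody (localVars R) (body R) n))) ⇔
                           I ⊨ᵢ τBody (L.map (substE (instanceSubst R (globalsOf ρ))) (body R))
  sat-ruleBody R n ρ =
    ⇔.trans (sat-bigAnd ρ _) (φBody-correct (localVars R) (body R) n ρ _ (body-grounds R ρ))

  sat-ruleHead : ∀ R ts ρ rs → (∀ x → x ∈ varsTs ts → x ∈ globalVars R) →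
                 L.map ρ (news 0 (length ts)) ≡ rs →
                 sat ρ (news 0 (length ts) ∈* ts) ⇔ ⟦ substTs (instanceSubst R (globalsOf ρ)) ts ⟧ˢ rs
  sat-ruleHead R ts ρ rs hts V≡rs =
    subst₂ (λ ts′ rs′ → sat ρ (V ∈* ts) ⇔ ⟦ ts′ ⟧ˢ rs′) ts≡ V≡rs (sat-∈* ρ V ts (length-news 0 (length ts)))
    where
      V = news 0 (length ts)
      ts≡ : substTs (groundSubst ρ) ts ≡ substTs (instanceSubst R (globalsOf ρ)) ts
      ts≡ = substTs-cong _ _ ts (λ x m → ≡-sym (instanceSubst-global R (globalsOf ρ) x (hts x m)))

  -- a disjunct of (τ₁ Γ)|_{p(rs)} contributed by the rule R
  InstanceDerives : Rule → PredName → List PTerm → Set₁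
  InstanceDerives R p rs = Σ (Var → PTerm) λ σ → Σ (HeadIx (head (instanceOf R σ))) λ j →
    let r = headRule (head (instanceOf R σ)) (body (instanceOf R σ)) j
    in (IRule.ihead r ≡ (p , rs)) × (I ⊨ᵢ IRule.ibody r)

  module RuleDisjunct (ρ₀ : Env) (p : PredName) (ts : List Term) (b : List BodyElem) (rs : List PTerm)
    (l : length rs ≡ length ts) where

    V : List FVar
    V = news 0 (length ts)

    ρV : Env
    ρV = updates ρ₀ V rs

    map-V : ∀ ρ′ → Agree ρ′ ρV V → L.map ρ′ V ≡ rs
    map-V ρ′ = map-agree-updates ρ₀ V rs ρ′ (news-unique 0 (length ts))
                                 (trans l (≡-sym (length-news 0 (length ts))))

    Φ : Head → Form
    Φ h = bigAnd (proj₁ (φBody (localVars (h ⇐ b)) b (length ts)))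

    Core : Head → Form
    Core h = V ∈* ts f∧ Φ h

    sat-Core : ∀ h ρ′ → Agree ρ′ ρV V → (∀ x → x ∈ varsTs ts → x ∈ globalVars (h ⇐ b)) →
      sat ρ′ (Core h) ⇔
        (⟦ substTs (instanceSubst (h ⇐ b) (globalsOf ρ′)) ts ⟧ˢ rs ×
         I ⊨ᵢ τBody (L.map (substE (instanceSubst (h ⇐ b) (globalsOf ρ′))) b))
    sat-Core h ρ′ ρ′≈ρV hts = ⇔.trans (sat-∧ ρ′ (V ∈* ts) (Φ h))
      (sat-ruleHead (h ⇐ b) ts ρ′ rs hts (map-V ρ′ ρ′≈ρV) ×-⇔ sat-ruleBody (h ⇐ b) (length ts) ρ′)

    basic-correct : sat ρV (∃-closure V (Core (basic p ts))) ⇔ InstanceDerives (basic p ts ⇐ b) p rs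
    basic-correct = mk⇔
      (λ s → let ρ′ , ρ′≈ρV , s′ = ∃-closure-elim V (Core H) ρV s
                 m , t = to (sat-Core H ρ′ ρ′≈ρV (head-var-global (H ⇐ b))) s′
             in globalsOf ρ′ , (rs , m) , refl , t)
      (λ { (σ , (_ , m) , refl , t) →
             let ρ′≈ρV = withGlobals-news σ ρV 0 (length ts) in
             ∃-closure-intro V (Core H) ρV (withGlobals σ ρV) ρ′≈ρV
               (from (sat-Core H _ ρ′≈ρV (head-var-global (H ⇐ b))) (m , t)) })
      where H = basic p ts

    V-evaluates : ∀ ρ′ → Agree ρ′ ρV V → evalAs ρ′ (L.map avar V) ≡ rs
    V-evaluates ρ′ ρ′≈ρV = trans (evalAs-avar ρ′ V) (map-V ρ′ ρ′≈ρV)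

    -- the conjunct p(V) of the representation of a choice rule matches ¬¬p(rs) in τ₁
    choice-correct : sat ρV (∃-closure V (Core (choice p ts) f∧ fatom p (L.map avar V))) ⇔
                     InstanceDerives (choice p ts ⇐ b) p rs
    choice-correct = mk⇔
      (λ s → let ρ′ , ρ′≈ρV , s′ = ∃-closure-elim V (Core H f∧ P) ρV s
                 c , i = to (sat-∧ ρ′ (Core H) P) s′
                 m , t = to (sat-Core H ρ′ ρ′≈ρV (head-var-global (H ⇐ b))) c
                 i′ = subst (I p) (V-evaluates ρ′ ρ′≈ρV) i
             in globalsOf ρ′ , (rs , m) , refl , λ { (lift true) → t ; (lift false) ¬i → ¬i (lift i′) })
      (λ { (σ , (_ , m) , refl , t) →
             let ρ′≈ρV = withGlobals-news σ ρV 0 (length ts)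
                 i = ¬¬-elim (λ ¬i → lower (t (lift false) (λ i → lift (¬i (lower i)))))
             in ∃-closure-intro V (Core H f∧ P) ρV (withGlobals σ ρV) ρ′≈ρV
                  (from (sat-∧ _ (Core H) P)
                    (from (sat-Core H _ ρ′≈ρV (head-var-global (H ⇐ b))) (m , t (lift true)) ,
                     subst (I p) (≡-sym (V-evaluates _ ρ′≈ρV)) i)) })
      where
        H = choice p ts
        P = fatom p (L.map avar V)

  Derives : Program → PredName → List PTerm → Set₁
  Derives Γ p rs = Σ (Fin (length Γ)) λ i → InstanceDerives (lookup Γ i) p rs

  HeadOf : Head → PredName → ℕ → Set
  HeadOf (basic q ts) p n = q ≡ p × length ts ≡ n
  HeadOf (choice q ts) p n = q ≡ p × length ts ≡ n
  HeadOf none p n = ⊥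

  derives⇒HeadOf : ∀ h b p rs → InstanceDerives (h ⇐ b) p rs → HeadOf h p (length rs)
  derives⇒HeadOf (basic q ts) b p rs (σ , (rs′ , m) , refl , _) =
    refl , ≡-sym (trans (⟦⟧ˢ-length _ rs′ m) (length-substTs _ ts))
  derives⇒HeadOf (choice q ts) b p rs (σ , (rs′ , m) , refl , _) =
    refl , ≡-sym (trans (⟦⟧ˢ-length _ rs′ m) (length-substTs _ ts))

  derives-∷ : ∀ R Γ p rs {P : Form → Set} D Ds → (P D ⇔ InstanceDerives R p rs) →
              (Any P Ds ⇔ Derives Γ p rs) → Any P (D ∷ Ds) ⇔ Derives (R ∷ Γ) p rs
  derives-∷ R Γ p rs D Ds e ih = mk⇔
    (λ { (here s) → Fin.zero , to e s ; (there a) → let i , r = to ih a in Fin.suc i , r })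
    (λ { (Fin.zero , r) → here (from e r) ; (Fin.suc i , r) → there (from ih (i , r)) })

  derives-skip : ∀ R Γ p rs {P : Form → Set} Ds → ¬ InstanceDerives R p rs →
                 (Any P Ds ⇔ Derives Γ p rs) → Any P Ds ⇔ Derives (R ∷ Γ) p rs
  derives-skip R Γ p rs Ds ¬r ih = mk⇔
    (λ a → let i , r = to ih a in Fin.suc i , r)
    (λ { (Fin.zero , r) → ⊥-elim (¬r r) ; (Fin.suc i , r) → from ih (i , r) })

  defDisjuncts-correct : ∀ Γ p n ρ₀ rs → length rs ≡ n →
    Any (sat (updates ρ₀ (news 0 n) rs)) (defDisjuncts Γ p n) ⇔ Derives Γ p rs
  defDisjuncts-correct [] p n ρ₀ rs l = mk⇔ (λ ()) (λ ())
  defDisjuncts-correct ((none ⇐ b) ∷ Γ) p n ρ₀ rs l =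
    derives-skip _ Γ p rs _ (derives⇒HeadOf none b p rs) (defDisjuncts-correct Γ p n ρ₀ rs l)
  defDisjuncts-correct ((basic q ts ⇐ b) ∷ Γ) p n ρ₀ rs l with q ≟P p | length ts ℕ.≟ n
  ... | yes refl | yes refl =
    derives-∷ _ Γ p rs _ _ (RuleDisjunct.basic-correct ρ₀ p ts b rs l) (defDisjuncts-correct Γ p n ρ₀ rs l)
  ... | no q≢p | _ = derives-skip _ Γ p rs _
    (q≢p ∘ proj₁ ∘ derives⇒HeadOf (basic q ts) b p rs) (defDisjuncts-correct Γ p n ρ₀ rs l)
  ... | yes _ | no ≢n = derives-skip _ Γ p rs _
    (≢n ∘ (λ e → trans e l) ∘ proj₂ ∘ derives⇒HeadOf (basic q ts) b p rs) (defDisjuncts-correct Γ p n ρ₀ rs l)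
  defDisjuncts-correct ((choice q ts ⇐ b) ∷ Γ) p n ρ₀ rs l with q ≟P p | length ts ℕ.≟ n
  ... | yes refl | yes refl =
    derives-∷ _ Γ p rs _ _ (RuleDisjunct.choice-correct ρ₀ p ts b rs l) (defDisjuncts-correct Γ p n ρ₀ rs l)
  ... | no q≢p | _ = derives-skip _ Γ p rs _
    (q≢p ∘ proj₁ ∘ derives⇒HeadOf (choice q ts) b p rs) (defDisjuncts-correct Γ p n ρ₀ rs l)
  ... | yes _ | no ≢n = derives-skip _ Γ p rs _
    (≢n ∘ (λ e → trans e l) ∘ proj₂ ∘ derives⇒HeadOf (choice q ts) b p rs) (defDisjuncts-correct Γ p n ρ₀ rs l)

  completedDef-correct : ∀ Γ p n → I ⊨ completedDef Γ p n ⇔ (∀ rs → length rs ≡ n → (I p rs ⇔ Derives Γ p rs))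
  completedDef-correct Γ p n = ⇔.trans (sat-∀* ρ₀ V (A f↔ bigOr D)) (mk⇔
    (λ h rs l → to (pointwise rs l) (h rs (length≡ rs l)))
    (λ h rs l → let l′ = trans l (length-news 0 n) in from (pointwise rs l′) (h rs l′)))
    where
      ρ₀ : Env
      ρ₀ _ = pinf
      V = news 0 n
      D = defDisjuncts Γ p n
      A = fatom p (L.map avar V)
      length≡ : ∀ rs → length rs ≡ n → length rs ≡ length V
      length≡ rs l = trans l (≡-sym (length-news 0 n))
      A≡ : ∀ rs → length rs ≡ n → evalAs (updates ρ₀ V rs) (L.map avar V) ≡ rs
      A≡ rs l = trans (evalAs-avar _ V) (map-updates ρ₀ V rs (news-unique 0 n) (length≡ rs l))
      pointwise : ∀ rs → length rs ≡ n → sat (updates ρ₀ V rs) (A f↔ bigOr D) ⇔ (I p rs ⇔ Derives Γ p rs)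
      pointwise rs l = ⇔.trans (sat-↔ _ A (bigOr D)) (⇔-cong
        (≡⇒⇔ (cong (I p) (A≡ rs l)))
        (⇔.trans (sat-bigOr _ D) (defDisjuncts-correct Γ p n ρ₀ rs l)))

  completion-correct : ∀ Γ → I ⊨ᵢ completion (Vocab Γ) (τ₁ Γ) ⇔
                             (∀ p rs → Occurs Γ p (length rs) → (I p rs ⇔ Derives Γ p rs))
  completion-correct Γ = mk⇔ completion⇒iff iff⇒completion
    where
      completion⇒iff : I ⊨ᵢ completion (Vocab Γ) (τ₁ Γ) →
                       ∀ p rs → Occurs Γ p (length rs) → (I p rs ⇔ Derives Γ p rs)
      completion⇒iff h p rs occ = mk⇔
        (λ i → let (lift (k , σ , j) , eq) , t = h (lift ((p , rs) , occ)) (lift true) (lift i)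
               in k , σ , j , eq , t)
        (λ (k , σ , j , eq , t) → lower (h (lift ((p , rs) , occ)) (lift false) ((lift (k , σ , j) , eq) , t)))

      iff⇒completion : (∀ p rs → Occurs Γ p (length rs) → (I p rs ⇔ Derives Γ p rs)) →
                       I ⊨ᵢ completion (Vocab Γ) (τ₁ Γ)
      iff⇒completion h (lift ((p , rs) , occ)) (lift true) (lift i) =
        let k , σ , j , eq , t = to (h p rs occ) i in (lift (k , σ , j) , eq) , t
      iff⇒completion h (lift ((p , rs) , occ)) (lift false) ((lift (k , σ , j) , eq) , t) =
        lift (from (h p rs occ) (k , σ , j , eq , t))

lemma5 : (S : Sig) (C : Ctx S) → ExcludedMiddle (lsuc 0ℓ) →
    (Γ : Syntax.Program S) (I : Syntax.Interp S) →
    (∀ p rs → I p rs → Syntax.Occurs S Γ p (length rs)) →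
    (Semantics._⊨ᵢ_ S C I (Semantics.completion S C (Syntax.Vocab S Γ) (Semantics.τ₁ S C Γ)))
      ⇔ (∀ p (n : ℕ) → Syntax.Occurs S Γ p n → Semantics._⊨_ S C I (Syntax.completedDef S Γ p n))
lemma5 S C em Γ I _ = mk⇔
  (λ h p n occ → from (completedDef-correct Γ p n) λ rs l →
     to (completion-correct Γ) h p rs (subst (Occurs Γ p) (≡-sym l) occ))
  (λ h → from (completion-correct Γ) λ p rs occ →
     to (completedDef-correct Γ p (length rs)) (h p (length rs) occ) rs refl)
  where
    open Syntax S using (Occurs)
    open Correctness S C em I
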